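{- For integers $n \ge 1$ and $k \ge 0$, let $L(n,k)$ be the number of permutations $w \in \mathfrak{S}_n$ of length $\ell(w) = k$ whose principal order ideal $B(w)$ in the Bruhat order is boolean (equivalently, by a result of the same paper, which avoid $321$ and $3412$). Then $$L(n,k) = \sum_{i=1}^k \binom{n-i}{k+1-i}\binom{k-1}{i-1},$$ where for $k=0$ the (empty) sum is defined to be $1$.
   Context: The length $\ell(w)$ of $w\in\mathfrak{S}_n$ is the minimal number of adjacent transpositions $s_i=(i\ i+1)$ whose product is $w$ (equal to the number of inversions of $w$). The Bruhat order on $\mathfrak{S}_n$ is the partial order generated by $w \lessdot w'$ whenever $\ell(w')=\ell(w)+1$ and $w'=tw$ for a transposition $t$; $B(w)=\{v \in \mathfrak{S}_n: v\le w\}$. A poset is boolean if it is isomorphic to the set of subsets of $\{1,\dots,r\}$ ordered by inclusion for some $r$. Binomial coefficients $\binom{a}{b}$ are $0$ when $b>a$. -}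

module Defs where

open import Data.Nat using (ℕ; zero; suc; _+_; _∸_; _<?_; _*_)
open import Data.Nat.Combinatorics using (_C_)
open import Data.Fin using (Fin; toℕ; _≟_)
open import Data.Fin.Subset using (Subset; _⊆_)
open import Data.Vec using (Vec; lookup; map)
open import Data.List using (List; allFin; applyUpTo)
open import Data.Nat.ListAction using (sum)
import Data.List as L
open import Data.Bool using (if_then_else_; _∧_)
open import Data.Product using (Σ; ∃; _×_)
open import Relation.Nullary using (¬_)
open import Relation.Nullary.Decidable using (⌊_⌋)
open import Relation.Binary.PropositionalEquality using (_≡_)
open import Relation.Binary.Construct.Closure.ReflexiveTransitive using (Star)

-- A permutation w ∈ S_n in one-line notation: w(i) = lookup w i.
Word : ℕ → Set
Word n = Vec (Fin n) n

IsPerm : ∀ {n} → Word n → Set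
IsPerm {n} w = ∀ (i j : Fin n) → lookup w i ≡ lookup w j → i ≡ j

len : ∀ {n} → Word n → ℕ
len {n} w = sum (L.map (λ i → sum (L.map (λ j →
  if ⌊ toℕ i <? toℕ j ⌋ ∧ ⌊ toℕ (lookup w j) <? toℕ (lookup w i) ⌋ then 1 else 0)
  (allFin n))) (allFin n))

transp : ∀ {n} → Fin n → Fin n → Fin n → Fin n
transp a b x = if ⌊ x ≟ a ⌋ then b else (if ⌊ x ≟ b ⌋ then a else x)

-- left multiplication t w (t ∘ w): swaps the values a and b in one-line notation
tmul : ∀ {n} → Fin n → Fin n → Word n → Word n
tmul a b w = map (transp a b) w

Cover : ∀ {n} → Word n → Word n → Set
Cover {n} w w' = Σ (Fin n) λ a → Σ (Fin n) λ b →
  (¬ (a ≡ b)) × (w' ≡ tmul a b w) × (len w' ≡ suc (len w))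

_≤B_ : ∀ {n} → Word n → Word n → Set
_≤B_ = Star Cover

InB : ∀ {n} → Word n → Word n → Set
InB w v = IsPerm v × (v ≤B w)

IsBooleanB : ∀ {n} → Word n → Set
IsBooleanB {n} w = Σ ℕ λ r →
  Σ (Word n → Subset r) λ f → Σ (Subset r → Word n) λ g →
    (∀ s → InB w (g s)) × (∀ s → f (g s) ≡ s) ×
    (∀ v → InB w v → g (f v) ≡ v) ×
    (∀ v v' → InB w v → InB w v' → (v ≤B v' → f v ⊆ f v') × (f v ⊆ f v' → v ≤B v'))

formula : ℕ → ℕ → ℕ
formula n zero = 1
formula n (suc k) = sum (applyUpTo (λ j → let i = suc j in
  ((n ∸ i) C (suc (suc k) ∸ i)) * (k C j)) (suc k))

module Submission where

-- A permutation has a boolean principal ideal exactly when it is a product of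
-- distinct simple reflections. Such products are encoded by codes: for each
-- j < n − 1 the reflection s_j is absent or multiplies the product of the lower
-- ones on the left or on the right. By the lifting property of the Bruhat order,
-- multiplying by a new s_j on either side doubles the ideal, so coded words are
-- boolean of rank equal to their length. Conversely, the atoms of a boolean ideal
-- of rank r ≥ ℓ(w) are r distinct simple reflections, all in the support of w, so
-- ℓ(w) is at most the size of the support; such a permutation is peeled into a
-- code letter by letter. Counting codes of length n − 1 and weight k by a
-- Pascal-type recursion gives the formula.

open import Defs
open import Data.Nat as ℕ using (ℕ; zero; suc; _+_; _*_; _∸_; _≤_; _<_; z≤n; s≤s; _<?_)
open import Data.Nat.Properties hiding (_≟_)
open import Data.Nat.Tactic.RingSolver using (solve-∀)
open import Data.Nat.ListAction using (sum)
open import Data.Nat.Combinatorics using (_C_; nCk+nC[k+1]≡[n+1]C[k+1]; k>n⇒nCk≡0)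
open import Data.Fin as F using (Fin; toℕ; _≟_; punchOut) renaming (zero to fzero; suc to fsuc)
open import Data.Fin.Properties as FP using (toℕ-injective; punchOut-injective; injective⇒≤)
open import Data.Vec as V using (Vec; lookup; []; _∷_; map; here; there)
open import Data.Vec.Properties using (lookup-map; lookup∘tabulate; tabulate∘lookup) renaming (tabulate-cong to tabulate-congᵛ)
open import Data.List as L using (List; []; _∷_; _++_; length; allFin; tabulate; applyUpTo)
open import Data.List.Properties using (map-tabulate; tabulate-cong; length-map; length-++; ∷-injectiveʳ)
open import Data.List.Membership.Propositional using (_∈_)
open import Data.List.Membership.Propositional.Properties using (∈-map⁺; ∈-map⁻; ∈-++⁺ˡ; ∈-++⁺ʳ; ∈-++⁻)
open import Data.List.Relation.Unary.Any using (here; there)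
open import Data.List.Relation.Unary.AllPairs using ([]; _∷_)
open import Data.List.Relation.Unary.Unique.Propositional using (Unique)
import Data.List.Relation.Unary.Unique.Propositional.Properties as Unique
open import Data.List.Relation.Unary.All as All using (All; []; _∷_)
open import Data.Bool using (Bool; true; false; if_then_else_; _∧_; not)
open import Data.Fin.Subset using (Subset; _⊆_; inside; outside; ∣_∣; ⁅_⁆) renaming (⊥ to ∅; _∈_ to _∈ₛ_)
open import Data.Fin.Subset.Properties using (drop-∷-⊆; p⊆q⇒∣p∣≤∣q∣; ∣p∣≤n; ∣⁅x⁆∣≡1; x∈⁅x⁆; x∈⁅y⁆⇒x≡y)
  renaming (∉⊥ to ∉∅)
open import Relation.Binary.Construct.Closure.ReflexiveTransitive using (Star; ε; _◅_; _◅◅_)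
open import Data.Sum using (_⊎_; inj₁; inj₂)
open import Function.Bundles using (_⇔_; mk⇔)
open import Data.Product using (Σ; ∃; _×_; _,_; proj₁; proj₂)
open import Relation.Nullary using (¬_; contradiction; Dec)
open import Data.Unit using (⊤; tt)
open import Data.Empty using (⊥; ⊥-elim)
open import Relation.Nullary.Decidable using (⌊_⌋; yes; no; _→-dec_)
open import Relation.Binary.Definitions using (tri<; tri≈; tri>)
open import Relation.Binary.PropositionalEquality
open import Function using (_∘_)

χ< : ℕ → ℕ → ℕ
χ< x y = if ⌊ x <? y ⌋ then 1 else 0

χ<-yes : ∀ {x y} → x < y → χ< x y ≡ 1
χ<-yes {x} {y} x<y with x <? y
... | yes _ = refl
... | no x≮y = contradiction x<y x≮y

χ<-no : ∀ {x y} → ¬ x < y → χ< x y ≡ 0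
χ<-no {x} {y} x≮y with x <? y
... | yes x<y = contradiction x<y x≮y
... | no _ = refl

⌊suc<?suc⌋ : ∀ a b → ⌊ suc a <? suc b ⌋ ≡ ⌊ a <? b ⌋
⌊suc<?suc⌋ a b with a <? b | suc a <? suc b
... | yes _ | yes _ = refl
... | no _ | no _ = refl
... | yes a<b | no sa≮sb = contradiction (s≤s a<b) sa≮sb
... | no a≮b | yes (s≤s a<b) = contradiction a<b a≮b

countBelow countAbove : ℕ → List ℕ → ℕ
countBelow x [] = 0
countBelow x (y ∷ ys) = χ< y x + countBelow x ys
countAbove x [] = 0
countAbove x (y ∷ ys) = χ< x y + countAbove x ys

countBetween : ℕ → ℕ → List ℕ → ℕ
countBetween a b [] = 0
countBetween a b (y ∷ ys) = χ< a y * χ< y b + countBetween a b ys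

inversions : List ℕ → ℕ
inversions [] = 0
inversions (x ∷ xs) = countBelow x xs + inversions xs

values : ∀ {n k} → Vec (Fin n) k → List ℕ
values [] = []
values (x ∷ v) = toℕ x ∷ values v

module _ {n : ℕ} where

  invertedPair : ∀ {k} → Vec (Fin n) k → Fin k → Fin k → ℕ
  invertedPair v i j =
    if ⌊ toℕ i <? toℕ j ⌋ ∧ ⌊ toℕ (lookup v j) <? toℕ (lookup v i) ⌋ then 1 else 0

  invertedPairs : ∀ {k} → Vec (Fin n) k → ℕ
  invertedPairs {k} v =
    sum (L.map (λ i → sum (L.map (invertedPair v i) (allFin k))) (allFin k))

  private
    Σ[_] : ∀ {k} → (Fin k → ℕ) → ℕ
    Σ[ f ] = sum (tabulate f)

    Σ-cong : ∀ {k} {f g : Fin k → ℕ} → (∀ i → f i ≡ g i) → Σ[ f ] ≡ Σ[ g ]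
    Σ-cong = cong sum ∘ tabulate-cong

    invertedPairs-tabulate : ∀ {k} (v : Vec (Fin n) k) →
      invertedPairs v ≡ Σ[ (λ i → Σ[ invertedPair v i ]) ]
    invertedPairs-tabulate {k} v = trans
      (cong sum (map-tabulate (λ i → i) (λ i → sum (L.map (invertedPair v i) (allFin k)))))
      (Σ-cong (λ i → cong sum (map-tabulate (λ j → j) (invertedPair v i))))

  -- The first row of the double sum counts the inversions involving the head;
  -- the remaining rows are those of the tail, since comparisons shift under suc.
  invertedPairs-∷ : ∀ {k} (x : Fin n) (v : Vec (Fin n) k) →
    invertedPairs (x ∷ v) ≡ countBelow (toℕ x) (values v) + invertedPairs v
  invertedPairs-∷ x v = begin
    invertedPairs (x ∷ v)
      ≡⟨ invertedPairs-tabulate (x ∷ v) ⟩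
    Σ[ (λ j → χ< (toℕ (lookup v j)) (toℕ x)) ] + Σ[ (λ i → Σ[ invertedPair (x ∷ v) (fsuc i) ∘ fsuc ]) ]
      ≡⟨ cong₂ _+_ (countBelow-tabulate v) (Σ-cong (λ i → Σ-cong (λ j → tail-pair i j))) ⟩
    countBelow (toℕ x) (values v) + Σ[ (λ i → Σ[ invertedPair v i ]) ]
      ≡⟨ cong (countBelow (toℕ x) (values v) +_) (invertedPairs-tabulate v) ⟨
    countBelow (toℕ x) (values v) + invertedPairs v ∎
    where
    open ≡-Reasoning
    countBelow-tabulate : ∀ {k} (u : Vec (Fin n) k) →
      Σ[ (λ j → χ< (toℕ (lookup u j)) (toℕ x)) ] ≡ countBelow (toℕ x) (values u)
    countBelow-tabulate [] = refl
    countBelow-tabulate (y ∷ u) = cong (χ< (toℕ y) (toℕ x) +_) (countBelow-tabulate u)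
    tail-pair : ∀ i j → invertedPair (x ∷ v) (fsuc i) (fsuc j) ≡ invertedPair v i j
    tail-pair i j rewrite ⌊suc<?suc⌋ (toℕ i) (toℕ j) = refl

invertedPairs≡inversions : ∀ {n k} (v : Vec (Fin n) k) → invertedPairs v ≡ inversions (values v)
invertedPairs≡inversions [] = refl
invertedPairs≡inversions (x ∷ v) =
  trans (invertedPairs-∷ x v) (cong (countBelow (toℕ x) (values v) +_) (invertedPairs≡inversions v))

-- Opaque, so that unification never unfolds the double sum defining len.
opaque
  ℓ : ∀ {n} → Word n → ℕ
  ℓ = len

  ℓ≡len : ∀ {n} (w : Word n) → ℓ w ≡ len w
  ℓ≡len w = refl

ℓ≡inversions : ∀ {n} (w : Word n) → ℓ w ≡ inversions (values w)
ℓ≡inversions w = trans (ℓ≡len w) (invertedPairs≡inversions w)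

countBelow-++ : ∀ x xs ys → countBelow x (xs ++ ys) ≡ countBelow x xs + countBelow x ys
countBelow-++ x [] ys = refl
countBelow-++ x (y ∷ xs) ys =
  trans (cong (χ< y x +_) (countBelow-++ x xs ys)) (sym (+-assoc (χ< y x) _ _))

inversions-exchange : ∀ a b ys zs →
  inversions (ys ++ a ∷ zs) + (countAbove b ys + countBelow b zs) ≡
  inversions (ys ++ b ∷ zs) + (countAbove a ys + countBelow a zs)
inversions-exchange a b [] zs = rotate (countBelow a zs) (inversions zs) (countBelow b zs)
  where
  rotate : ∀ p q r → p + q + r ≡ r + q + p
  rotate = solve-∀
inversions-exchange a b (y ∷ ys) zs = begin
  countBelow y (ys ++ a ∷ zs) + inversions (ys ++ a ∷ zs) + (χ< b y + countAbove b ys + countBelow b zs)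
    ≡⟨ cong (λ t → t + _ + _) (countBelow-++ y ys (a ∷ zs)) ⟩
  countBelow y ys + (χ< a y + countBelow y zs) + inversions (ys ++ a ∷ zs) + (χ< b y + countAbove b ys + countBelow b zs)
    ≡⟨ shuffle (countBelow y ys) (χ< a y) (countBelow y zs) _ (χ< b y) _ _ ⟩
  countBelow y ys + countBelow y zs + (χ< a y + χ< b y) + (inversions (ys ++ a ∷ zs) + (countAbove b ys + countBelow b zs))
    ≡⟨ cong₂ (λ s t → countBelow y ys + countBelow y zs + s + t) (+-comm (χ< a y) (χ< b y)) (inversions-exchange a b ys zs) ⟩
  countBelow y ys + countBelow y zs + (χ< b y + χ< a y) + (inversions (ys ++ b ∷ zs) + (countAbove a ys + countBelow a zs))
    ≡⟨ shuffle (countBelow y ys) (χ< b y) (countBelow y zs) _ (χ< a y) _ _ ⟨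
  countBelow y ys + (χ< b y + countBelow y zs) + inversions (ys ++ b ∷ zs) + (χ< a y + countAbove a ys + countBelow a zs)
    ≡⟨ cong (λ t → t + _ + _) (countBelow-++ y ys (b ∷ zs)) ⟨
  countBelow y (ys ++ b ∷ zs) + inversions (ys ++ b ∷ zs) + (χ< a y + countAbove a ys + countBelow a zs) ∎
  where
  open ≡-Reasoning
  shuffle : ∀ c p z X q g h → c + (p + z) + X + (q + g + h) ≡ c + z + (p + q) + (X + (g + h))
  shuffle = solve-∀

Avoids : ℕ → ℕ → ℕ → Set
Avoids a b y = y ≢ a × y ≢ b

χ<-between : ∀ {a b y} → a < b → Avoids a b y →
  χ< y b + χ< a y ≡ χ< y a + χ< b y + 2 * (χ< a y * χ< y b)
χ<-between {a} {b} {y} a<b (y≢a , y≢b) with <-cmp y a | <-cmp y b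
... | tri≈ _ y≡a _ | _ = contradiction y≡a y≢a
... | _ | tri≈ _ y≡b _ = contradiction y≡b y≢b
... | tri< y<a _ _ | tri< y<b _ _
  rewrite χ<-yes y<b | χ<-no (<⇒≯ y<a) | χ<-yes y<a | χ<-no (<⇒≯ y<b) = refl
... | tri< y<a _ _ | tri> _ _ b<y = contradiction (<-trans b<y (<-trans y<a a<b)) (<-irrefl refl)
... | tri> _ _ a<y | tri< y<b _ _
  rewrite χ<-yes y<b | χ<-yes a<y | χ<-no (<⇒≯ a<y) | χ<-no (<⇒≯ y<b) = refl
... | tri> _ _ a<y | tri> _ _ b<y
  rewrite χ<-no (<⇒≯ b<y) | χ<-yes a<y | χ<-no (<⇒≯ a<y) | χ<-yes b<y = refl

countBelow+countAbove : ∀ {a b} → a < b → ∀ ys → All (Avoids a b) ys →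
  countBelow b ys + countAbove a ys ≡ countBelow a ys + countAbove b ys + 2 * countBetween a b ys
countBelow+countAbove a<b [] [] = refl
countBelow+countAbove {a} {b} a<b (y ∷ ys) (avoid ∷ avoids) = begin
  χ< y b + countBelow b ys + (χ< a y + countAbove a ys)
    ≡⟨ interchange (χ< y b) _ (χ< a y) _ ⟩
  χ< y b + χ< a y + (countBelow b ys + countAbove a ys)
    ≡⟨ cong₂ _+_ (χ<-between a<b avoid) (countBelow+countAbove a<b ys avoids) ⟩
  χ< y a + χ< b y + 2 * (χ< a y * χ< y b) + (countBelow a ys + countAbove b ys + 2 * countBetween a b ys)
    ≡⟨ regroup (χ< y a) (χ< b y) (χ< a y * χ< y b) _ _ _ ⟩
  χ< y a + countBelow a ys + (χ< b y + countAbove b ys) + 2 * (χ< a y * χ< y b + countBetween a b ys) ∎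
  where
  open ≡-Reasoning
  interchange : ∀ p q r s → p + q + (r + s) ≡ p + r + (q + s)
  interchange = solve-∀
  regroup : ∀ p q r s t u → p + q + 2 * r + (s + t + 2 * u) ≡ p + s + (q + t) + 2 * (r + u)
  regroup = solve-∀

-- Adding countAbove a ys to both sides turns the claim into the sum of the two
-- previous identities.
inversions-swap-head : ∀ {a b} → a < b → ∀ ys zs → All (Avoids a b) ys →
  inversions (b ∷ ys ++ a ∷ zs) ≡ suc (inversions (a ∷ ys ++ b ∷ zs) + 2 * countBetween a b ys)
inversions-swap-head {a} {b} a<b ys zs avoids = +-cancelʳ-≡ (countAbove a ys) _ _ (begin
  countBelow b (ys ++ a ∷ zs) + X + countAbove a ys
    ≡⟨ cong (λ t → t + X + countAbove a ys) (countBelow-++ b ys (a ∷ zs)) ⟩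
  countBelow b ys + (χ< a b + countBelow b zs) + X + countAbove a ys
    ≡⟨ cong (λ t → countBelow b ys + (t + countBelow b zs) + X + countAbove a ys) (χ<-yes a<b) ⟩
  countBelow b ys + (1 + countBelow b zs) + X + countAbove a ys
    ≡⟨ shuffle₁ (countBelow b ys) (countBelow b zs) X (countAbove a ys) ⟩
  countBelow b ys + countAbove a ys + suc (X + countBelow b zs)
    ≡⟨ cong (_+ suc (X + countBelow b zs)) (countBelow+countAbove a<b ys avoids) ⟩
  countBelow a ys + countAbove b ys + 2 * t + suc (X + countBelow b zs)
    ≡⟨ shuffle₂ (countBelow a ys) (countAbove b ys) t X (countBelow b zs) ⟩
  suc (countBelow a ys + 2 * t + (X + (countAbove b ys + countBelow b zs)))
    ≡⟨ cong (λ u → suc (countBelow a ys + 2 * t + u)) (inversions-exchange a b ys zs) ⟩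
  suc (countBelow a ys + 2 * t + (Y + (countAbove a ys + countBelow a zs)))
    ≡⟨ shuffle₃ (countBelow a ys) t Y (countAbove a ys) (countBelow a zs) ⟩
  suc (countBelow a ys + (0 + countBelow a zs) + Y + 2 * t) + countAbove a ys
    ≡⟨ cong (λ u → suc (countBelow a ys + (u + countBelow a zs) + Y + 2 * t) + countAbove a ys) (χ<-no (<⇒≯ a<b)) ⟨
  suc (countBelow a ys + (χ< b a + countBelow a zs) + Y + 2 * t) + countAbove a ys
    ≡⟨ cong (λ u → suc (u + Y + 2 * t) + countAbove a ys) (countBelow-++ a ys (b ∷ zs)) ⟨
  suc (countBelow a (ys ++ b ∷ zs) + Y + 2 * t) + countAbove a ys ∎)
  where
  open ≡-Reasoning
  X = inversions (ys ++ a ∷ zs)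
  Y = inversions (ys ++ b ∷ zs)
  t = countBetween a b ys
  shuffle₁ : ∀ p q x g → p + (1 + q) + x + g ≡ p + g + suc (x + q)
  shuffle₁ = solve-∀
  shuffle₂ : ∀ p g s x q → p + g + 2 * s + suc (x + q) ≡ suc (p + 2 * s + (x + (g + q)))
  shuffle₂ = solve-∀
  shuffle₃ : ∀ p s y g q → suc (p + 2 * s + (y + (g + q))) ≡ suc (p + (0 + q) + y + 2 * s) + g
  shuffle₃ = solve-∀

countBelow-swap : ∀ x a b ys zs → countBelow x (b ∷ ys ++ a ∷ zs) ≡ countBelow x (a ∷ ys ++ b ∷ zs)
countBelow-swap x a b ys zs = begin
  χ< b x + countBelow x (ys ++ a ∷ zs)
    ≡⟨ cong (χ< b x +_) (countBelow-++ x ys (a ∷ zs)) ⟩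
  χ< b x + (countBelow x ys + (χ< a x + countBelow x zs))
    ≡⟨ exchange (χ< b x) (countBelow x ys) (χ< a x) (countBelow x zs) ⟩
  χ< a x + (countBelow x ys + (χ< b x + countBelow x zs))
    ≡⟨ cong (χ< a x +_) (countBelow-++ x ys (b ∷ zs)) ⟨
  χ< a x + countBelow x (ys ++ b ∷ zs) ∎
  where
  open ≡-Reasoning
  exchange : ∀ p q r s → p + (q + (r + s)) ≡ r + (q + (p + s))
  exchange = solve-∀

inversions-prefix : ∀ (us us′ : List ℕ) t → (∀ x → countBelow x us ≡ countBelow x us′) →
  inversions us ≡ suc (inversions us′ + t) →
  ∀ xs → inversions (xs ++ us) ≡ suc (inversions (xs ++ us′) + t)
inversions-prefix us us′ t same-counts eq [] = eq
inversions-prefix us us′ t same-counts eq (x ∷ xs) = begin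
  countBelow x (xs ++ us) + inversions (xs ++ us)
    ≡⟨ cong₂ _+_ same-prefixed-counts (inversions-prefix us us′ t same-counts eq xs) ⟩
  countBelow x (xs ++ us′) + suc (inversions (xs ++ us′) + t)
    ≡⟨ shuffle (countBelow x (xs ++ us′)) (inversions (xs ++ us′)) t ⟩
  suc (countBelow x (xs ++ us′) + inversions (xs ++ us′) + t) ∎
  where
  open ≡-Reasoning
  same-prefixed-counts : countBelow x (xs ++ us) ≡ countBelow x (xs ++ us′)
  same-prefixed-counts = trans (countBelow-++ x xs us)
    (trans (cong (countBelow x xs +_) (same-counts x)) (sym (countBelow-++ x xs us′)))
  shuffle : ∀ p q r → p + suc (q + r) ≡ suc (p + q + r)
  shuffle = solve-∀

inversions-swap : ∀ {a b} → a < b → ∀ xs ys zs → All (Avoids a b) ys →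
  inversions (xs ++ b ∷ ys ++ a ∷ zs) ≡ suc (inversions (xs ++ a ∷ ys ++ b ∷ zs) + 2 * countBetween a b ys)
inversions-swap {a} {b} a<b xs ys zs avoids =
  inversions-prefix (b ∷ ys ++ a ∷ zs) (a ∷ ys ++ b ∷ zs) _ (λ x → countBelow-swap x a b ys zs)
    (inversions-swap-head a<b ys zs avoids) xs

record Perm {n} (w : Word n) : Set where
  constructor perm
  field lookup-injective : IsPerm w
open Perm public

vec-ext : ∀ {a} {A : Set a} {k} {u v : Vec A k} → (∀ i → lookup u i ≡ lookup v i) → u ≡ v
vec-ext {u = u} {v} eq = trans (sym (tabulate∘lookup u)) (trans (tabulate-congᵛ eq) (tabulate∘lookup v))

module _ {n : ℕ} where

  transp-left : (a b : Fin n) → transp a b a ≡ b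
  transp-left a b with a ≟ a
  ... | yes _ = refl
  ... | no a≢a = contradiction refl a≢a

  transp-right : (a b : Fin n) → transp a b b ≡ a
  transp-right a b with b ≟ a
  ... | yes b≡a = b≡a
  ... | no _ with b ≟ b
  ...   | yes _ = refl
  ...   | no b≢b = contradiction refl b≢b

  transp-other : (a b x : Fin n) → x ≢ a → x ≢ b → transp a b x ≡ x
  transp-other a b x x≢a x≢b with x ≟ a
  ... | yes x≡a = contradiction x≡a x≢a
  ... | no _ with x ≟ b
  ...   | yes x≡b = contradiction x≡b x≢b
  ...   | no _ = refl

  data TranspCase (a b x : Fin n) : Set where
    is-left : x ≡ a → TranspCase a b x
    is-right : x ≡ b → x ≢ a → TranspCase a b x
    is-other : x ≢ a → x ≢ b → TranspCase a b x

  transpCase : (a b x : Fin n) → TranspCase a b x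
  transpCase a b x with x ≟ a
  ... | yes x≡a = is-left x≡a
  ... | no x≢a with x ≟ b
  ...   | yes x≡b = is-right x≡b x≢a
  ...   | no x≢b = is-other x≢a x≢b

  transp-involutive : (a b x : Fin n) → transp a b (transp a b x) ≡ x
  transp-involutive a b x with transpCase a b x
  ... | is-left refl = trans (cong (transp x b) (transp-left x b)) (transp-right x b)
  ... | is-right refl _ = trans (cong (transp a x) (transp-right a x)) (transp-left a x)
  ... | is-other x≢a x≢b =
    trans (cong (transp a b) (transp-other a b x x≢a x≢b)) (transp-other a b x x≢a x≢b)

  transp-comm : (a b x : Fin n) → transp a b x ≡ transp b a x
  transp-comm a b x with transpCase a b x
  ... | is-left refl = trans (transp-left x b) (sym (transp-right b x))
  ... | is-right refl _ = trans (transp-right a x) (sym (transp-left x a))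
  ... | is-other x≢a x≢b = trans (transp-other a b x x≢a x≢b) (sym (transp-other b a x x≢b x≢a))

  transp-injective : (a b : Fin n) {x y : Fin n} → transp a b x ≡ transp a b y → x ≡ y
  transp-injective a b {x} {y} eq =
    trans (sym (transp-involutive a b x)) (trans (cong (transp a b) eq) (transp-involutive a b y))

  transp-conjugate : (a b c d x : Fin n) →
    transp c d (transp a b x) ≡ transp (transp c d a) (transp c d b) (transp c d x)
  transp-conjugate a b c d x with transpCase a b x
  ... | is-left refl =
    trans (cong (transp c d) (transp-left x b)) (sym (transp-left (transp c d x) (transp c d b)))
  ... | is-right refl _ =
    trans (cong (transp c d) (transp-right a x)) (sym (transp-right (transp c d a) (transp c d x)))
  ... | is-other x≢a x≢b = trans (cong (transp c d) (transp-other a b x x≢a x≢b))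
    (sym (transp-other _ _ _ (x≢a ∘ transp-injective c d) (x≢b ∘ transp-injective c d)))

  lookup-tmul : (a b : Fin n) (w : Word n) (i : Fin n) → lookup (tmul a b w) i ≡ transp a b (lookup w i)
  lookup-tmul a b w i = lookup-map i (transp a b) w

  tmul-involutive : (a b : Fin n) (w : Word n) → tmul a b (tmul a b w) ≡ w
  tmul-involutive a b w = vec-ext λ i → trans (lookup-tmul a b (tmul a b w) i)
    (trans (cong (transp a b) (lookup-tmul a b w i)) (transp-involutive a b (lookup w i)))

  tmul-comm : (a b : Fin n) (w : Word n) → tmul a b w ≡ tmul b a w
  tmul-comm a b w = vec-ext λ i → trans (lookup-tmul a b w i)
    (trans (transp-comm a b (lookup w i)) (sym (lookup-tmul b a w i)))

  tmul-conjugate : (a b c d : Fin n) (w : Word n) →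
    tmul c d (tmul a b w) ≡ tmul (transp c d a) (transp c d b) (tmul c d w)
  tmul-conjugate a b c d w = vec-ext λ i → begin
    lookup (tmul c d (tmul a b w)) i
      ≡⟨ lookup-tmul c d (tmul a b w) i ⟩
    transp c d (lookup (tmul a b w) i)
      ≡⟨ cong (transp c d) (lookup-tmul a b w i) ⟩
    transp c d (transp a b (lookup w i))
      ≡⟨ transp-conjugate a b c d (lookup w i) ⟩
    transp (transp c d a) (transp c d b) (transp c d (lookup w i))
      ≡⟨ cong (transp (transp c d a) (transp c d b)) (lookup-tmul c d w i) ⟨
    transp (transp c d a) (transp c d b) (lookup (tmul c d w) i)
      ≡⟨ lookup-tmul (transp c d a) (transp c d b) (tmul c d w) i ⟨
    lookup (tmul (transp c d a) (transp c d b) (tmul c d w)) i ∎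
    where open ≡-Reasoning

  tmul-cong : {s s′ t t′ : Fin n} {w w′ : Word n} →
    s ≡ s′ → t ≡ t′ → w ≡ w′ → tmul s t w ≡ tmul s′ t′ w′
  tmul-cong refl refl refl = refl

  tmul-perm : (a b : Fin n) {w : Word n} → Perm w → Perm (tmul a b w)
  tmul-perm a b {w} w-perm = perm λ i j eq → lookup-injective w-perm i j (transp-injective a b
    (trans (sym (lookup-tmul a b w i)) (trans eq (lookup-tmul a b w j))))

  lookup-tmul-left : (a b : Fin n) (w : Word n) (i : Fin n) → lookup w i ≡ a → lookup (tmul a b w) i ≡ b
  lookup-tmul-left a b w i wi≡a = trans (lookup-tmul a b w i) (trans (cong (transp a b) wi≡a) (transp-left a b))

  lookup-tmul-right : (a b : Fin n) (w : Word n) (i : Fin n) → lookup w i ≡ b → lookup (tmul a b w) i ≡ a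
  lookup-tmul-right a b w i wi≡b = trans (lookup-tmul a b w i) (trans (cong (transp a b) wi≡b) (transp-right a b))

  lookup-tmul-other : (a b : Fin n) (w : Word n) (i : Fin n) → lookup w i ≢ a → lookup w i ≢ b →
    lookup (tmul a b w) i ≡ lookup w i
  lookup-tmul-other a b w i wi≢a wi≢b = trans (lookup-tmul a b w i) (transp-other a b _ wi≢a wi≢b)

  swapPos : Fin n → Fin n → Word n → Word n
  swapPos p q w = V.tabulate (λ k → lookup w (transp p q k))

  lookup-swapPos : (p q : Fin n) (w : Word n) (k : Fin n) → lookup (swapPos p q w) k ≡ lookup w (transp p q k)
  lookup-swapPos p q w k = lookup∘tabulate _ k

  swapPos≡tmul : (p q : Fin n) {w : Word n} → Perm w → swapPos p q w ≡ tmul (lookup w p) (lookup w q) w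
  swapPos≡tmul p q {w} w-perm = vec-ext λ k →
    trans (lookup-swapPos p q w k) (sym (trans (lookup-tmul (lookup w p) (lookup w q) w k) (transp-lookup k)))
    where
    transp-lookup : ∀ k → transp (lookup w p) (lookup w q) (lookup w k) ≡ lookup w (transp p q k)
    transp-lookup k with transpCase p q k
    ... | is-left refl = trans (transp-left (lookup w k) (lookup w q)) (cong (lookup w) (sym (transp-left k q)))
    ... | is-right refl _ = trans (transp-right (lookup w p) (lookup w k)) (cong (lookup w) (sym (transp-right p k)))
    ... | is-other k≢p k≢q = trans
      (transp-other (lookup w p) (lookup w q) (lookup w k)
        (k≢p ∘ lookup-injective w-perm k p) (k≢q ∘ lookup-injective w-perm k q))
      (cong (lookup w) (sym (transp-other p q k k≢p k≢q)))

  swapPos-tmul : (p q a b : Fin n) (w : Word n) → swapPos p q (tmul a b w) ≡ tmul a b (swapPos p q w)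
  swapPos-tmul p q a b w = vec-ext λ k → trans (lookup-swapPos p q (tmul a b w) k)
    (trans (lookup-tmul a b w (transp p q k))
      (sym (trans (lookup-tmul a b (swapPos p q w) k) (cong (transp a b) (lookup-swapPos p q w k)))))

  swapPos-involutive : (p q : Fin n) (w : Word n) → swapPos p q (swapPos p q w) ≡ w
  swapPos-involutive p q w = vec-ext λ k → trans (lookup-swapPos p q (swapPos p q w) k)
    (trans (lookup-swapPos p q w (transp p q k)) (cong (lookup w) (transp-involutive p q k)))

  swapPos-perm : (p q : Fin n) {w : Word n} → Perm w → Perm (swapPos p q w)
  swapPos-perm p q {w} w-perm = perm λ i j eq → transp-injective p q
    (lookup-injective w-perm _ _ (trans (sym (lookup-swapPos p q w i)) (trans eq (lookup-swapPos p q w j))))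

injective⇒surjective : ∀ {n} (f : Fin n → Fin n) → (∀ i j → f i ≡ f j → i ≡ j) → ∀ y → ∃ λ p → f p ≡ y
injective⇒surjective {zero} f f-inj ()
injective⇒surjective {suc n} f f-inj y with FP.any? (λ p → f p ≟ y)
... | yes hit = hit
... | no miss = contradiction (injective⇒≤ {f = avoid-y} avoid-y-injective) (<-irrefl refl)
  where
  avoid-y : Fin (suc n) → Fin n
  avoid-y i = punchOut {i = y} (λ eq → miss (i , sym eq))
  avoid-y-injective : ∀ {i j} → avoid-y i ≡ avoid-y j → i ≡ j
  avoid-y-injective {i} {j} eq =
    f-inj i j (punchOut-injective (λ eq → miss (i , sym eq)) (λ eq → miss (j , sym eq)) eq)

preimage : ∀ {n} {w : Word n} → Perm w → ∀ y → ∃ λ p → lookup w p ≡ y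
preimage {w = w} w-perm = injective⇒surjective (lookup w) (lookup-injective w-perm)

OtherValue : ∀ {n k} → Vec (Fin n) k → Fin k → Fin k → ℕ → Set
OtherValue z p q y = ∃ λ r → r ≢ p × r ≢ q × y ≡ toℕ (lookup z r)

values-split : ∀ {n k} (z z′ : Vec (Fin n) k) (q : Fin k) → (∀ r → r ≢ q → lookup z r ≡ lookup z′ r) →
  Σ (List ℕ) λ ys → Σ (List ℕ) λ zs →
    values z ≡ ys ++ toℕ (lookup z q) ∷ zs × values z′ ≡ ys ++ toℕ (lookup z′ q) ∷ zs ×
    All (λ y → ∃ λ r → toℕ r < toℕ q × y ≡ toℕ (lookup z r)) ys × length ys ≡ toℕ q
values-split (x ∷ v) (x′ ∷ v′) fzero agree = [] , values v , refl ,
  cong (λ u → toℕ x′ ∷ values u) (sym (vec-ext (λ r → agree (fsuc r) (λ ())))) , [] , refl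
values-split (x ∷ v) (x′ ∷ v′) (fsuc q) agree
  with values-split v v′ q (λ r r≢q → agree (fsuc r) (r≢q ∘ FP.suc-injective))
... | ys , zs , eq , eq′ , before , len-ys rewrite agree fzero (λ ()) =
  toℕ x′ ∷ ys , zs , cong (toℕ x′ ∷_) eq , cong (toℕ x′ ∷_) eq′ ,
  (fzero , s≤s z≤n , refl) ∷ All.map (λ { (r , r<q , e) → fsuc r , s≤s r<q , e }) before , cong suc len-ys

values-split₂ : ∀ {n k} (z z′ : Vec (Fin n) k) (p q : Fin k) → toℕ p < toℕ q →
  (∀ r → r ≢ p → r ≢ q → lookup z r ≡ lookup z′ r) →
  Σ (List ℕ) λ xs → Σ (List ℕ) λ ys → Σ (List ℕ) λ zs →
    values z ≡ xs ++ toℕ (lookup z p) ∷ ys ++ toℕ (lookup z q) ∷ zs ×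
    values z′ ≡ xs ++ toℕ (lookup z′ p) ∷ ys ++ toℕ (lookup z′ q) ∷ zs ×
    All (OtherValue z p q) ys × (toℕ q ≡ suc (toℕ p) → ys ≡ [])
values-split₂ (x ∷ v) (x′ ∷ v′) fzero (fsuc q) _ agree
  with values-split v v′ q (λ r r≢q → agree (fsuc r) (λ ()) (r≢q ∘ FP.suc-injective))
... | ys , zs , eq , eq′ , before , len-ys =
  [] , ys , zs , cong (toℕ x ∷_) eq , cong (toℕ x′ ∷_) eq′ ,
  All.map (λ { (r , r<q , e) → fsuc r , (λ ()) , (λ r≡q → <-irrefl (cong toℕ (FP.suc-injective r≡q)) r<q) , e }) before ,
  λ adjacent → length≡0⇒[] ys (trans len-ys (suc-injective adjacent))
  where
  length≡0⇒[] : (l : List ℕ) → length l ≡ 0 → l ≡ []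
  length≡0⇒[] [] _ = refl
values-split₂ (x ∷ v) (x′ ∷ v′) (fsuc p) (fsuc q) (s≤s p<q) agree
  with values-split₂ v v′ p q p<q (λ r r≢p r≢q → agree (fsuc r) (r≢p ∘ FP.suc-injective) (r≢q ∘ FP.suc-injective))
... | xs , ys , zs , eq , eq′ , between , adjacent⇒ε rewrite agree fzero (λ ()) (λ ()) =
  toℕ x′ ∷ xs , ys , zs , cong (toℕ x′ ∷_) eq , cong (toℕ x′ ∷_) eq′ ,
  All.map (λ { (r , r≢p , r≢q , e) → fsuc r , (r≢p ∘ FP.suc-injective) , (r≢q ∘ FP.suc-injective) , e }) between ,
  adjacent⇒ε ∘ suc-injective

countBetween-adjacent : ∀ a ys → countBetween a (suc a) ys ≡ 0
countBetween-adjacent a [] = refl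
countBetween-adjacent a (y ∷ ys) with a <? y
... | no _ = countBetween-adjacent a ys
... | yes a<y rewrite χ<-no {y} {suc a} (λ y<sa → <-irrefl refl (<-≤-trans a<y (≤-pred y<sa))) =
  countBetween-adjacent a ys

module _ {n : ℕ} where

  -- The correction term t counts the values strictly between the two swapped ones
  -- that sit strictly between the two positions.
  ℓ-transpose : {z : Word n} → Perm z → (p q : Fin n) → toℕ p < toℕ q →
    toℕ (lookup z q) < toℕ (lookup z p) →
    ∃ λ t → ℓ z ≡ suc (ℓ (tmul (lookup z p) (lookup z q) z) + 2 * t) ×
            (toℕ q ≡ suc (toℕ p) → t ≡ 0) × (toℕ (lookup z p) ≡ suc (toℕ (lookup z q)) → t ≡ 0)
  ℓ-transpose {z} z-perm p q p<q descent with values-split₂ z z′ p q p<q agree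
    where
    z′ = tmul (lookup z p) (lookup z q) z
    agree : ∀ r → r ≢ p → r ≢ q → lookup z r ≡ lookup z′ r
    agree r r≢p r≢q = sym (trans (lookup-tmul _ _ z r)
      (transp-other _ _ _ (r≢p ∘ lookup-injective z-perm r p) (r≢q ∘ lookup-injective z-perm r q)))
  ... | xs , ys , zs , eq , eq′ , between , adjacent⇒ε =
    countBetween a b ys , ℓ-eq ,
    (λ adjacent → cong (countBetween a b) (adjacent⇒ε adjacent)) ,
    (λ adjacent → trans (cong (λ u → countBetween a u ys) adjacent) (countBetween-adjacent a ys))
    where
    a = toℕ (lookup z q)
    b = toℕ (lookup z p)
    z′ = tmul (lookup z p) (lookup z q) z
    z′p : lookup z′ p ≡ lookup z q
    z′p = trans (lookup-tmul (lookup z p) (lookup z q) z p) (transp-left (lookup z p) (lookup z q))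
    z′q : lookup z′ q ≡ lookup z p
    z′q = trans (lookup-tmul (lookup z p) (lookup z q) z q) (transp-right (lookup z p) (lookup z q))
    avoids : All (Avoids a b) ys
    avoids = All.map (λ { (r , r≢p , r≢q , refl) →
      (r≢q ∘ lookup-injective z-perm r q ∘ toℕ-injective) ,
        (r≢p ∘ lookup-injective z-perm r p ∘ toℕ-injective) }) between
    ℓ-eq : ℓ z ≡ suc (ℓ z′ + 2 * countBetween a b ys)
    ℓ-eq = begin
      ℓ z
        ≡⟨ ℓ≡inversions z ⟩
      inversions (values z)
        ≡⟨ cong inversions eq ⟩
      inversions (xs ++ b ∷ ys ++ a ∷ zs)
        ≡⟨ inversions-swap descent xs ys zs avoids ⟩
      suc (inversions (xs ++ a ∷ ys ++ b ∷ zs) + 2 * countBetween a b ys)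
        ≡⟨ cong (λ l → suc (inversions l + 2 * countBetween a b ys))
             (trans eq′ (cong₂ (λ u u′ → xs ++ toℕ u ∷ ys ++ toℕ u′ ∷ zs) z′p z′q)) ⟨
      suc (inversions (values z′) + 2 * countBetween a b ys)
        ≡⟨ cong (λ u → suc (u + 2 * countBetween a b ys)) (ℓ≡inversions z′) ⟨
      suc (ℓ z′ + 2 * countBetween a b ys) ∎
      where open ≡-Reasoning

  ℓ-transpose-< : {z : Word n} → Perm z → (p q : Fin n) → toℕ p < toℕ q →
    toℕ (lookup z q) < toℕ (lookup z p) → ℓ (tmul (lookup z p) (lookup z q) z) < ℓ z
  ℓ-transpose-< {z} z-perm p q p<q descent =
    let (t , ℓ-eq , _) = ℓ-transpose z-perm p q p<q descent
    in subst (ℓ (tmul (lookup z p) (lookup z q) z) <_) (sym ℓ-eq) (s≤s (m≤m+n _ (2 * t)))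

  private
    no-correction : ∀ {x t} → t ≡ 0 → suc (x + 2 * t) ≡ suc x
    no-correction refl = cong suc (+-identityʳ _)

  ℓ-transpose-adjacentPositions : {z : Word n} → Perm z → (p q : Fin n) → toℕ q ≡ suc (toℕ p) →
    toℕ (lookup z q) < toℕ (lookup z p) → ℓ z ≡ suc (ℓ (tmul (lookup z p) (lookup z q) z))
  ℓ-transpose-adjacentPositions {z} z-perm p q adjacent descent =
    let (t , ℓ-eq , t≡0 , _) = ℓ-transpose z-perm p q (subst (toℕ p <_) (sym adjacent) ≤-refl) descent
    in trans ℓ-eq (no-correction (t≡0 adjacent))

  ℓ-transpose-adjacentValues : {z : Word n} → Perm z → (p q : Fin n) → toℕ p < toℕ q →
    toℕ (lookup z p) ≡ suc (toℕ (lookup z q)) → ℓ z ≡ suc (ℓ (tmul (lookup z p) (lookup z q) z))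
  ℓ-transpose-adjacentValues {z} z-perm p q p<q adjacent =
    let (t , ℓ-eq , _ , t≡0) = ℓ-transpose z-perm p q p<q (subst (toℕ (lookup z q) <_) (sym adjacent) ≤-refl)
    in trans ℓ-eq (no-correction (t≡0 adjacent))
module _ {n : ℕ} where

  record FixesAbove (j : ℕ) (w : Word n) : Set where
    constructor fixesAbove
    field fixesAt : ∀ q → j < toℕ q → lookup w q ≡ q
  open FixesAbove public

  Closed≤ : ℕ → Word n → Set
  Closed≤ i w = ∀ q → toℕ q ≤ i → toℕ (lookup w q) ≤ i

  record _⋖_ (v x : Word n) : Set where
    field
      a b : Fin n
      a≢b : a ≢ b
      x≡tmul : x ≡ tmul a b v
      ℓ≡suc : ℓ x ≡ suc (ℓ v)

  module ⋖ = _⋖_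

  Cover→⋖ : {v x : Word n} → Cover v x → v ⋖ x
  Cover→⋖ (a , b , a≢b , x≡ , len≡) =
    record { a = a ; b = b ; a≢b = a≢b ; x≡tmul = x≡ ;
      ℓ≡suc = trans (ℓ≡len _) (trans len≡ (cong suc (sym (ℓ≡len _)))) }

  ⋖→Cover : {v x : Word n} → v ⋖ x → Cover v x
  ⋖→Cover c = ⋖.a c , ⋖.b c , ⋖.a≢b c , ⋖.x≡tmul c ,
    trans (sym (ℓ≡len _)) (trans (⋖.ℓ≡suc c) (cong suc (ℓ≡len _)))

  ⋖-flip : {v x : Word n} → v ⋖ x → v ⋖ x
  ⋖-flip {v} c = record
    { a = ⋖.b c ; b = ⋖.a c ; a≢b = ⋖.a≢b c ∘ sym
    ; x≡tmul = trans (⋖.x≡tmul c) (tmul-comm _ _ v) ; ℓ≡suc = ⋖.ℓ≡suc c }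

  ⋖-perm : {v x : Word n} → Perm v → v ⋖ x → Perm x
  ⋖-perm {v} v-perm c = subst Perm (sym (⋖.x≡tmul c)) (tmul-perm _ _ v-perm)

  ⋖-back : {v x : Word n} (c : v ⋖ x) → v ≡ tmul (⋖.a c) (⋖.b c) x
  ⋖-back {v} c = trans (sym (tmul-involutive _ _ v)) (cong (tmul _ _) (sym (⋖.x≡tmul c)))

  ⋖-lookup-a : {v x : Word n} (c : v ⋖ x) (i : Fin n) → lookup x i ≡ ⋖.a c → lookup v i ≡ ⋖.b c
  ⋖-lookup-a {v} {x} c i xi≡a = trans (cong (λ w → lookup w i) (⋖-back c)) (lookup-tmul-left _ _ x i xi≡a)

  ⋖-lookup-b : {v x : Word n} (c : v ⋖ x) (i : Fin n) → lookup x i ≡ ⋖.b c → lookup v i ≡ ⋖.a c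
  ⋖-lookup-b {v} {x} c i xi≡b = trans (cong (λ w → lookup w i) (⋖-back c)) (lookup-tmul-right _ _ x i xi≡b)

  ⋖-lookup-other : {v x : Word n} (c : v ⋖ x) (i : Fin n) → lookup x i ≢ ⋖.a c → lookup x i ≢ ⋖.b c →
    lookup v i ≡ lookup x i
  ⋖-lookup-other {v} {x} c i xi≢a xi≢b =
    trans (cong (λ w → lookup w i) (⋖-back c)) (lookup-tmul-other _ _ x i xi≢a xi≢b)

  ⋖-direction : {v x : Word n} → Perm v → (c : v ⋖ x) → ∀ u u′ →
    lookup x u ≡ ⋖.a c → lookup x u′ ≡ ⋖.b c → toℕ u < toℕ u′ → toℕ (⋖.b c) < toℕ (⋖.a c)
  ⋖-direction {v} {x} v-perm c u u′ xu xu′ u<u′ with <-cmp (toℕ (⋖.b c)) (toℕ (⋖.a c))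
  ... | tri< b<a _ _ = b<a
  ... | tri≈ _ b≡a _ = contradiction (toℕ-injective (sym b≡a)) (⋖.a≢b c)
  ... | tri> _ _ a<b = contradiction (subst (_< ℓ v) ℓ-undo (ℓ-transpose-< v-perm u u′ u<u′ descent))
                                     (<⇒≯ (subst (ℓ v <_) (sym (⋖.ℓ≡suc c)) ≤-refl))
    where
    vu : lookup v u ≡ ⋖.b c
    vu = ⋖-lookup-a c u xu
    vu′ : lookup v u′ ≡ ⋖.a c
    vu′ = ⋖-lookup-b c u′ xu′
    descent : toℕ (lookup v u′) < toℕ (lookup v u)
    descent = subst₂ (λ s t → toℕ s < toℕ t) (sym vu′) (sym vu) a<b
    ℓ-undo : ℓ (tmul (lookup v u) (lookup v u′) v) ≡ ℓ x
    ℓ-undo = cong ℓ (trans (cong₂ (λ s t → tmul s t v) vu vu′)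
                           (trans (tmul-comm _ _ v) (sym (⋖.x≡tmul c))))

  private
    -- The value a sits at a fixed position beyond j; wherever b sits, ⋖-direction
    -- contradicts b being fixed as well.
    ⋖-moves-below : {v x : Word n} {j : ℕ} → Perm v → (c : v ⋖ x) → FixesAbove j x → j < toℕ (⋖.a c) → ⊥
    ⋖-moves-below {v} {x} {j} v-perm c x-fix j<a with preimage (⋖-perm v-perm c) (⋖.b c)
    ... | r , xr with <-cmp (toℕ (⋖.a c)) (toℕ r)
    ... | tri< a<r _ _ = <-irrefl refl (<-trans b<a (subst (λ t → toℕ (⋖.a c) < toℕ t) r≡b a<r))
      where
      b<a = ⋖-direction v-perm c (⋖.a c) r (fixesAt x-fix _ j<a) xr a<r
      r≡b : r ≡ ⋖.b c
      r≡b = trans (sym (fixesAt x-fix r (<-trans j<a a<r))) xr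
    ... | tri≈ _ a≡r _ =
      ⋖.a≢b c (trans (sym (fixesAt x-fix _ j<a)) (trans (cong (lookup x) (toℕ-injective a≡r)) xr))
    ... | tri> _ _ r<a = <-irrefl refl (<-trans (subst (λ t → toℕ t < toℕ (⋖.a c)) r≡b r<a) a<b)
      where
      a<b = ⋖-direction v-perm (⋖-flip c) r (⋖.a c) xr (fixesAt x-fix _ j<a) r<a
      r≡b : r ≡ ⋖.b c
      r≡b = lookup-injective (⋖-perm v-perm c) r (⋖.b c) (trans xr (sym (fixesAt x-fix _ (<-trans j<a a<b))))

  fixesAbove-⋖ : {v x : Word n} {j : ℕ} → Perm v → v ⋖ x → FixesAbove j x → FixesAbove j v
  fixesAbove-⋖ {v} {x} {j} v-perm c x-fix = fixesAbove fixed
    where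
    fixed : ∀ q → j < toℕ q → lookup v q ≡ q
    fixed q j<q with transpCase (⋖.a c) (⋖.b c) q
    ... | is-left refl = ⊥-elim (⋖-moves-below v-perm c x-fix j<q)
    ... | is-right refl _ = ⊥-elim (⋖-moves-below v-perm (⋖-flip c) x-fix j<q)
    ... | is-other q≢a q≢b = trans (⋖-lookup-other c q (xq≢ q≢a) (xq≢ q≢b)) (fixesAt x-fix q j<q)
      where
      xq≢ : ∀ {t} → q ≢ t → lookup x q ≢ t
      xq≢ q≢t xq≡t = q≢t (trans (sym (fixesAt x-fix q j<q)) xq≡t)

  private
    ⋖-closed-value : {v x : Word n} {i : ℕ} → Perm v → (c : v ⋖ x) → Closed≤ i x → ∀ q → toℕ q ≤ i →
      lookup x q ≡ ⋖.a c → toℕ (⋖.b c) ≤ i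
    ⋖-closed-value {v} {x} {i} v-perm c x-closed q q≤i xq with preimage (⋖-perm v-perm c) (⋖.b c)
    ... | r , xr with toℕ r ℕ.≤? i
    ... | yes r≤i = subst (λ t → toℕ t ≤ i) xr (x-closed r r≤i)
    ... | no r≰i = <⇒≤ (<-≤-trans (⋖-direction v-perm c q r xq xr (≤-<-trans q≤i (≰⇒> r≰i)))
                                  (subst (λ t → toℕ t ≤ i) xq (x-closed q q≤i)))

  closed≤-⋖ : {v x : Word n} {i : ℕ} → Perm v → v ⋖ x → Closed≤ i x → Closed≤ i v
  closed≤-⋖ {v} {x} {i} v-perm c x-closed q q≤i with transpCase (⋖.a c) (⋖.b c) (lookup x q)
  ... | is-left xq≡a = subst (λ t → toℕ t ≤ i) (sym (⋖-lookup-a c q xq≡a))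
    (⋖-closed-value v-perm c x-closed q q≤i xq≡a)
  ... | is-right xq≡b _ = subst (λ t → toℕ t ≤ i) (sym (⋖-lookup-b c q xq≡b))
    (⋖-closed-value v-perm (⋖-flip c) x-closed q q≤i xq≡b)
  ... | is-other xq≢a xq≢b = subst (λ t → toℕ t ≤ i) (sym (⋖-lookup-other c q xq≢a xq≢b))
    (x-closed q q≤i)

  _≼_ : Word n → Word n → Set
  _≼_ = Star _⋖_

  ≤B→≼ : {v w : Word n} → v ≤B w → v ≼ w
  ≤B→≼ ε = ε
  ≤B→≼ (_◅_ {i = v} {j = x} c s) = Cover→⋖ {v} {x} c ◅ ≤B→≼ s

  ≼→≤B : {v w : Word n} → v ≼ w → v ≤B w
  ≼→≤B ε = ε
  ≼→≤B (_◅_ {i = v} {j = x} c s) = ⋖→Cover {v} {x} c ◅ ≼→≤B s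

  _◅ʳ_ : {x y z : Word n} → x ≼ y → y ⋖ z → x ≼ z
  ε ◅ʳ c = c ◅ ε
  (c′ ◅ s) ◅ʳ c = c′ ◅ (s ◅ʳ c)

  ≼-perm : {v w : Word n} → Perm v → v ≼ w → Perm w
  ≼-perm v-perm ε = v-perm
  ≼-perm v-perm (c ◅ s) = ≼-perm (⋖-perm v-perm c) s

  fixesAbove-≼ : {v w : Word n} {j : ℕ} → Perm v → v ≼ w → FixesAbove j w → FixesAbove j v
  fixesAbove-≼ v-perm ε w-fix = w-fix
  fixesAbove-≼ v-perm (c ◅ s) w-fix = fixesAbove-⋖ v-perm c (fixesAbove-≼ (⋖-perm v-perm c) s w-fix)

  closed≤-≼ : {v w : Word n} {i : ℕ} → Perm v → v ≼ w → Closed≤ i w → Closed≤ i v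
  closed≤-≼ v-perm ε w-closed = w-closed
  closed≤-≼ v-perm (c ◅ s) w-closed = closed≤-⋖ v-perm c (closed≤-≼ (⋖-perm v-perm c) s w-closed)

  ℓ-≼ : {v w : Word n} → v ≼ w → ℓ v ≤ ℓ w
  ℓ-≼ ε = ≤-refl
  ℓ-≼ (c ◅ s) = ≤-trans (≤-trans (n≤1+n _) (≤-reflexive (sym (⋖.ℓ≡suc c)))) (ℓ-≼ s)

  ℓ-⋖◅≼ : {v w x : Word n} → v ⋖ x → x ≼ w → ℓ v < ℓ w
  ℓ-⋖◅≼ c s = <-≤-trans (≤-reflexive (sym (⋖.ℓ≡suc c))) (ℓ-≼ s)

-- min i m in Fin (suc m); being total, it lets words be built from codes without
-- carrying bound proofs.
clamp : (m : ℕ) → ℕ → Fin (suc m)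
clamp zero _ = fzero
clamp (suc m) zero = fzero
clamp (suc m) (suc i) = fsuc (clamp m i)

toℕ-clamp : ∀ m i → i ≤ m → toℕ (clamp m i) ≡ i
toℕ-clamp zero zero _ = refl
toℕ-clamp (suc m) zero _ = refl
toℕ-clamp (suc m) (suc i) (s≤s i≤m) = cong suc (toℕ-clamp m i i≤m)

clamp-toℕ : ∀ m (q : Fin (suc m)) → clamp m (toℕ q) ≡ q
clamp-toℕ zero fzero = refl
clamp-toℕ (suc m) fzero = refl
clamp-toℕ (suc m) (fsuc q) = cong fsuc (clamp-toℕ m q)

module _ {n : ℕ} where

  fixesAbove-suc : ∀ {j} {v : Word n} → FixesAbove j v → FixesAbove (suc j) v
  fixesAbove-suc {j} v-fix = fixesAbove λ q sj<q → fixesAt v-fix q (<-trans (n<1+n j) sj<q)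

  fixesAbove-pred : ∀ {j} {v : Word n} (d : Fin n) → toℕ d ≡ suc j →
    FixesAbove (suc j) v → lookup v d ≡ d → FixesAbove j v
  fixesAbove-pred {j} {v} d d≡sj v-fix vd≡d = fixesAbove fixed
    where
    fixed : ∀ q → j < toℕ q → lookup v q ≡ q
    fixed q j<q with toℕ q ℕ.≟ suc j
    ... | yes q≡sj = subst (λ t → lookup v t ≡ t) (toℕ-injective (trans d≡sj (sym q≡sj))) vd≡d
    ... | no q≢sj = fixesAt v-fix q (≤∧≢⇒< j<q (q≢sj ∘ sym))

  fixed-position : ∀ {k} {x : Word n} {e : Fin n} → FixesAbove k x → ∀ r → lookup x r ≡ e → k < toℕ r → r ≡ e
  fixed-position x-fix r xr≡e k<r = trans (sym (fixesAt x-fix r k<r)) xr≡e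

  fixed-value : ∀ {k} {x : Word n} {e : Fin n} → Perm x → FixesAbove k x →
    ∀ r → lookup x r ≡ e → k < toℕ e → r ≡ e
  fixed-value x-perm x-fix r xr≡e k<e = lookup-injective x-perm r _ (trans xr≡e (sym (fixesAt x-fix _ k<e)))

  position-below : ∀ {j} {y : Word n} {c : Fin n} → FixesAbove j y →
    ∀ p → lookup y p ≡ c → toℕ c ≤ j → toℕ p ≤ j
  position-below {j} y-fix p yp≡c c≤j with toℕ p ℕ.≤? j
  ... | yes p≤j = p≤j
  ... | no p≰j = contradiction (subst (λ t → toℕ t ≤ j) (sym (fixed-position y-fix p yp≡c (≰⇒> p≰j))) c≤j) p≰j

  value-below : ∀ {j} {y : Word n} → Perm y → FixesAbove j y → ∀ p → toℕ p ≤ j → toℕ (lookup y p) ≤ j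
  value-below {j} {y} y-perm y-fix p p≤j with toℕ (lookup y p) ℕ.≤? j
  ... | yes yp≤j = yp≤j
  ... | no yp≰j = contradiction (subst (λ t → toℕ t ≤ j) (fixed-value y-perm y-fix p refl (≰⇒> yp≰j)) p≤j) yp≰j

-- Multiplication by the simple reflection s_j on one side, acting on the
-- permutations of {0, …, j} (those fixing every position beyond j); σ-lift is
-- the lifting property of the Bruhat order.
record SideMultiplication {n : ℕ} (j : ℕ) : Set where
  field
    σ : Word n → Word n
    σ-involutive : ∀ y → σ (σ y) ≡ y
    σ-perm : ∀ {y} → Perm y → Perm (σ y)
    σ-fixesAbove : ∀ {y} → Perm y → FixesAbove j y → FixesAbove (suc j) (σ y)
    σ-moves : ∀ {y} → Perm y → FixesAbove j y → ¬ FixesAbove j (σ y)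
    σ-⋖ : ∀ {y} → Perm y → FixesAbove j y → y ⋖ σ y
    σ-mono : ∀ {y y′} → Perm y → FixesAbove j y → Perm y′ → FixesAbove j y′ → y ⋖ y′ → σ y ⋖ σ y′
    σ-lift : ∀ {y v} → Perm y → FixesAbove j y → Perm v → v ⋖ σ y →
             v ≡ y ⊎ (σ v ⋖ y × ¬ FixesAbove j v)

module Adjacent (m j : ℕ) (j<m : j < m) where
  c d : Fin (suc m)
  c = clamp m j
  d = clamp m (suc j)

  toℕ-c : toℕ c ≡ j
  toℕ-c = toℕ-clamp m j (<⇒≤ j<m)

  toℕ-d : toℕ d ≡ suc j
  toℕ-d = toℕ-clamp m (suc j) j<m

  c≢d : c ≢ d
  c≢d c≡d = 1+n≢n (trans (sym toℕ-d) (trans (cong toℕ (sym c≡d)) toℕ-c))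

  j<d : j < toℕ d
  j<d = subst (j <_) (sym toℕ-d) ≤-refl

  above⇒≢c : ∀ {q} → j < toℕ q → q ≢ c
  above⇒≢c j<q q≡c = <-irrefl (sym (trans (cong toℕ q≡c) toℕ-c)) j<q

  above⇒≢d : ∀ {q} → suc j < toℕ q → q ≢ d
  above⇒≢d sj<q q≡d = <-irrefl (sym (trans (cong toℕ q≡d) toℕ-d)) sj<q

  above⇒above-d : ∀ {q} → j < toℕ q → q ≢ d → suc j < toℕ q
  above⇒above-d j<q q≢d = ≤∧≢⇒< j<q (λ sj≡q → q≢d (toℕ-injective (trans (sym sj≡q) (sym toℕ-d))))

module Left (m j : ℕ) (j<m : j < m) where
  open Adjacent m j j<m

  σ : Word (suc m) → Word (suc m)
  σ = tmul c d

  σ-fixesAbove : ∀ {y} → FixesAbove j y → FixesAbove (suc j) (σ y)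
  σ-fixesAbove {y} y-fix = fixesAbove λ q sj<q → let j<q = <-trans (n<1+n j) sj<q in
    trans (lookup-tmul-other c d y q (above⇒≢c j<q ∘ yq≡ j<q) (above⇒≢d sj<q ∘ yq≡ j<q)) (fixesAt y-fix q j<q)
    where
    yq≡ : ∀ {q t} → j < toℕ q → lookup y q ≡ t → q ≡ t
    yq≡ j<q yq≡t = trans (sym (fixesAt y-fix _ j<q)) yq≡t

  σ-at-d : ∀ {y} → FixesAbove j y → lookup (σ y) d ≡ c
  σ-at-d {y} y-fix = lookup-tmul-right c d y d (fixesAt y-fix d j<d)

  σ-moves : ∀ {y} → FixesAbove j y → ¬ FixesAbove j (σ y)
  σ-moves y-fix σy-fix = c≢d (trans (sym (σ-at-d y-fix)) (fixesAt σy-fix d j<d))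

  -- The value j sits at a position p ≤ j, before position j + 1 which holds j + 1.
  ℓ-σ : ∀ {y} → Perm y → FixesAbove j y → ℓ (σ y) ≡ suc (ℓ y)
  ℓ-σ {y} y-perm y-fix =
    trans (ℓ-transpose-adjacentValues (tmul-perm c d y-perm) p d p<d values-adjacent) (cong (suc ∘ ℓ) undo)
    where
    p = proj₁ (preimage y-perm c)
    yp≡c = proj₂ (preimage y-perm c)
    σyp≡d : lookup (σ y) p ≡ d
    σyp≡d = lookup-tmul-left c d y p yp≡c
    p<d : toℕ p < toℕ d
    p<d = subst (toℕ p <_) (sym toℕ-d) (s≤s (position-below y-fix p yp≡c (≤-reflexive toℕ-c)))
    values-adjacent : toℕ (lookup (σ y) p) ≡ suc (toℕ (lookup (σ y) d))
    values-adjacent = trans (cong toℕ σyp≡d) (trans toℕ-d (cong suc (sym (trans (cong toℕ (σ-at-d y-fix)) toℕ-c))))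
    undo : tmul (lookup (σ y) p) (lookup (σ y) d) (σ y) ≡ y
    undo = trans (cong₂ (λ s t → tmul s t (σ y)) σyp≡d (σ-at-d y-fix)) (trans (tmul-comm d c (σ y)) (tmul-involutive c d y))

  σ-⋖ : ∀ {y} → Perm y → FixesAbove j y → y ⋖ σ y
  σ-⋖ y-perm y-fix = record { a = c ; b = d ; a≢b = c≢d ; x≡tmul = refl ; ℓ≡suc = ℓ-σ y-perm y-fix }

  σ-mono : ∀ {y y′} → Perm y → FixesAbove j y → Perm y′ → FixesAbove j y′ → y ⋖ y′ → σ y ⋖ σ y′
  σ-mono {y} {y′} y-perm y-fix y′-perm y′-fix cov = record
    { a = transp c d (⋖.a cov) ; b = transp c d (⋖.b cov) ; a≢b = ⋖.a≢b cov ∘ transp-injective c d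
    ; x≡tmul = trans (cong σ (⋖.x≡tmul cov)) (tmul-conjugate _ _ c d y)
    ; ℓ≡suc = trans (ℓ-σ y′-perm y′-fix) (cong suc (trans (⋖.ℓ≡suc cov) (sym (ℓ-σ y-perm y-fix)))) }

  module LeftLift {y v : Word (suc m)} (y-perm : Perm y) (y-fix : FixesAbove j y) (v-perm : Perm v)
                  (cov : v ⋖ σ y) where
    private
      x = σ y
      x-perm : Perm x
      x-perm = tmul-perm c d y-perm
      x-fix : FixesAbove (suc j) x
      x-fix = σ-fixesAbove y-fix
      xd≡c : lookup x d ≡ c
      xd≡c = σ-at-d y-fix
      ℓv≡ℓy : ℓ v ≡ ℓ y
      ℓv≡ℓy = suc-injective (trans (sym (⋖.ℓ≡suc cov)) (ℓ-σ y-perm y-fix))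
      p = proj₁ (preimage y-perm c)
      yp≡c = proj₂ (preimage y-perm c)
      xp≡d : lookup x p ≡ d
      xp≡d = lookup-tmul-left c d y p yp≡c
      p≤j : toℕ p ≤ j
      p≤j = position-below y-fix p yp≡c (≤-reflexive toℕ-c)
      p<d : toℕ p < toℕ d
      p<d = subst (toℕ p <_) (sym toℕ-d) (s≤s p≤j)

    descends : (P : Fin (suc m)) → lookup v P ≡ d → toℕ P < toℕ d → lookup v d ≡ c →
      (α β : Fin (suc m)) → α ≢ β → σ v ≡ tmul α β y → σ v ⋖ y × ¬ FixesAbove j v
    descends P vP≡d P<d vd≡c α β α≢β σv≡ = σv⋖y , v-moves
      where
      values-adjacent : toℕ (lookup v P) ≡ suc (toℕ (lookup v d))
      values-adjacent = trans (cong toℕ vP≡d) (trans toℕ-d (cong suc (sym (trans (cong toℕ vd≡c) toℕ-c))))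
      undo : tmul (lookup v P) (lookup v d) v ≡ σ v
      undo = trans (cong₂ (λ s t → tmul s t v) vP≡d vd≡c) (tmul-comm d c v)
      σv⋖y : σ v ⋖ y
      σv⋖y = record
        { a = α ; b = β ; a≢b = α≢β
        ; x≡tmul = sym (trans (cong (tmul α β) σv≡) (tmul-involutive α β y))
        ; ℓ≡suc = trans (sym ℓv≡ℓy)
          (trans (ℓ-transpose-adjacentValues v-perm P d P<d values-adjacent) (cong (suc ∘ ℓ) undo)) }
      v-moves : ¬ FixesAbove j v
      v-moves v-fix = c≢d (trans (sym vd≡c) (fixesAt v-fix d j<d))

    same-transposition : (k : v ⋖ x) → ⋖.a k ≡ c → ⋖.b k ≡ d → v ≡ y
    same-transposition k a≡c b≡d = trans (⋖-back k) (trans (cong₂ (λ s t → tmul s t x) a≡c b≡d) (tmul-involutive c d y))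

    c-and-other-impossible : (k : v ⋖ x) → ⋖.a k ≡ c → ⋖.b k ≢ c → ⋖.b k ≢ d → ⊥
    c-and-other-impossible k a≡c b≢c b≢d with preimage x-perm (⋖.b k)
    ... | r , xr≡b with <-cmp (toℕ d) (toℕ r)
    ... | tri< d<r _ _ = <-irrefl refl (<-trans b<j (<-trans (n<1+n j) (subst (suc j <_) (cong toℕ r≡b) sj<r)))
      where
      b<j : toℕ (⋖.b k) < j
      b<j = subst (toℕ (⋖.b k) <_) (trans (cong toℕ a≡c) toℕ-c)
        (⋖-direction v-perm k d r (trans xd≡c (sym a≡c)) xr≡b d<r)
      sj<r : suc j < toℕ r
      sj<r = subst (_< toℕ r) toℕ-d d<r
      r≡b : r ≡ ⋖.b k
      r≡b = fixed-position x-fix r xr≡b sj<r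
    ... | tri≈ _ d≡r _ = b≢c (trans (sym xr≡b) (trans (cong (lookup x) (sym (toℕ-injective d≡r))) xd≡c))
    ... | tri> _ _ r<d = <-irrefl refl (<-trans (subst (_< toℕ d) (cong toℕ r≡b) r<d)
        (subst (_< toℕ (⋖.b k)) (sym toℕ-d) sj<b))
      where
      a<b : toℕ (⋖.a k) < toℕ (⋖.b k)
      a<b = ⋖-direction v-perm (⋖-flip k) r d xr≡b (trans xd≡c (sym a≡c)) r<d
      sj<b : suc j < toℕ (⋖.b k)
      sj<b = above⇒above-d (subst (_< toℕ (⋖.b k)) (trans (cong toℕ a≡c) toℕ-c) a<b) b≢d
      r≡b : r ≡ ⋖.b k
      r≡b = fixed-value x-perm x-fix r xr≡b sj<b

    d-and-other : (k : v ⋖ x) → ⋖.a k ≡ d → ⋖.b k ≢ c → ⋖.b k ≢ d → σ v ⋖ y × ¬ FixesAbove j v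
    d-and-other k a≡d b≢c b≢d with preimage x-perm (⋖.b k)
    ... | r , xr≡b with <-cmp (toℕ p) (toℕ r)
    ... | tri≈ _ p≡r _ = ⊥-elim (b≢d (trans (sym xr≡b) (trans (cong (lookup x) (sym (toℕ-injective p≡r))) xp≡d)))
    ... | tri> _ _ r<p = ⊥-elim (<-irrefl refl (<-trans (subst (_< toℕ p) (cong toℕ r≡b) r<p)
        (≤-<-trans p≤j (<-trans (n<1+n j) sj<b))))
      where
      a<b : toℕ (⋖.a k) < toℕ (⋖.b k)
      a<b = ⋖-direction v-perm (⋖-flip k) r p xr≡b (trans xp≡d (sym a≡d)) r<p
      sj<b : suc j < toℕ (⋖.b k)
      sj<b = subst (_< toℕ (⋖.b k)) (trans (cong toℕ a≡d) toℕ-d) a<b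
      r≡b : r ≡ ⋖.b k
      r≡b = fixed-value x-perm x-fix r xr≡b sj<b
    ... | tri< p<r _ _ = descends r vr≡d r<d vd≡c c (⋖.b k) (b≢c ∘ sym) σv≡
      where
      b<d : toℕ (⋖.b k) < toℕ d
      b<d = subst (toℕ (⋖.b k) <_) (cong toℕ a≡d) (⋖-direction v-perm k p r (trans xp≡d (sym a≡d)) xr≡b p<r)
      r<d : toℕ r < toℕ d
      r<d with <-cmp (toℕ r) (toℕ d)
      ... | tri< r<d _ _ = r<d
      ... | tri≈ _ r≡d _ = ⊥-elim (b≢c (trans (sym xr≡b) (trans (cong (lookup x) (toℕ-injective r≡d)) xd≡c)))
      ... | tri> _ _ d<r = ⊥-elim (<-irrefl refl (<-trans b<d (subst (toℕ d <_)
              (cong toℕ (fixed-position x-fix r xr≡b (subst (_< toℕ r) toℕ-d d<r))) d<r)))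
      vr≡d : lookup v r ≡ d
      vr≡d = trans (⋖-lookup-b k r xr≡b) a≡d
      vd≡c : lookup v d ≡ c
      vd≡c = trans (⋖-lookup-other k d (λ e → c≢d (trans (sym xd≡c) (trans e a≡d)))
        (λ e → b≢c (trans (sym e) xd≡c))) xd≡c
      σv≡ : σ v ≡ tmul c (⋖.b k) y
      σv≡ = trans (cong σ (⋖-back k)) (trans (tmul-conjugate (⋖.a k) (⋖.b k) c d x)
              (tmul-cong (trans (cong (transp c d) a≡d) (transp-right c d)) (transp-other c d _ b≢c b≢d)
                         (tmul-involutive c d y)))

    disjoint : ⋖.a cov ≢ c → ⋖.a cov ≢ d → ⋖.b cov ≢ c → ⋖.b cov ≢ d → σ v ⋖ y × ¬ FixesAbove j v
    disjoint a≢c a≢d b≢c b≢d = descends p vp≡d p<d vd≡c (⋖.a cov) (⋖.b cov) (⋖.a≢b cov) σv≡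
      where
      vp≡d : lookup v p ≡ d
      vp≡d = trans (⋖-lookup-other cov p (λ e → a≢d (trans (sym e) xp≡d)) (λ e → b≢d (trans (sym e) xp≡d))) xp≡d
      vd≡c : lookup v d ≡ c
      vd≡c = trans (⋖-lookup-other cov d (λ e → a≢c (trans (sym e) xd≡c)) (λ e → b≢c (trans (sym e) xd≡c))) xd≡c
      σv≡ : σ v ≡ tmul (⋖.a cov) (⋖.b cov) y
      σv≡ = trans (cong σ (⋖-back cov)) (trans (tmul-conjugate (⋖.a cov) (⋖.b cov) c d x)
              (tmul-cong (transp-other c d _ a≢c a≢d) (transp-other c d _ b≢c b≢d) (tmul-involutive c d y)))

    by-cases : TranspCase c d (⋖.a cov) → TranspCase c d (⋖.b cov) → v ≡ y ⊎ (σ v ⋖ y × ¬ FixesAbove j v)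
    by-cases (is-left a≡c) (is-left b≡c) = ⊥-elim (⋖.a≢b cov (trans a≡c (sym b≡c)))
    by-cases (is-left a≡c) (is-right b≡d _) = inj₁ (same-transposition cov a≡c b≡d)
    by-cases (is-left a≡c) (is-other b≢c b≢d) = ⊥-elim (c-and-other-impossible cov a≡c b≢c b≢d)
    by-cases (is-right a≡d _) (is-left b≡c) = inj₁ (same-transposition (⋖-flip cov) b≡c a≡d)
    by-cases (is-right a≡d _) (is-right b≡d _) = ⊥-elim (⋖.a≢b cov (trans a≡d (sym b≡d)))
    by-cases (is-right a≡d _) (is-other b≢c b≢d) = inj₂ (d-and-other cov a≡d b≢c b≢d)
    by-cases (is-other a≢c a≢d) (is-left b≡c) = ⊥-elim (c-and-other-impossible (⋖-flip cov) b≡c a≢c a≢d)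
    by-cases (is-other a≢c a≢d) (is-right b≡d _) = inj₂ (d-and-other (⋖-flip cov) b≡d a≢c a≢d)
    by-cases (is-other a≢c a≢d) (is-other b≢c b≢d) = inj₂ (disjoint a≢c a≢d b≢c b≢d)

  leftMultiplication : SideMultiplication {suc m} j
  leftMultiplication = record
    { σ = σ
    ; σ-involutive = tmul-involutive c d
    ; σ-perm = tmul-perm c d
    ; σ-fixesAbove = λ _ → σ-fixesAbove
    ; σ-moves = λ _ → σ-moves
    ; σ-⋖ = σ-⋖
    ; σ-mono = σ-mono
    ; σ-lift = λ y-perm y-fix v-perm cov → LeftLift.by-cases y-perm y-fix v-perm cov (transpCase c d _) (transpCase c d _) }

module Right (m j : ℕ) (j<m : j < m) where
  open Adjacent m j j<m

  σ : Word (suc m) → Word (suc m)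
  σ = swapPos c d

  σ-fixesAbove : ∀ {y} → FixesAbove j y → FixesAbove (suc j) (σ y)
  σ-fixesAbove {y} y-fix = fixesAbove λ q sj<q → let j<q = <-trans (n<1+n j) sj<q in
    trans (lookup-swapPos c d y q) (trans (cong (lookup y) (transp-other c d q (above⇒≢c j<q) (above⇒≢d sj<q)))
      (fixesAt y-fix q j<q))

  σ-at-c : ∀ {y} → FixesAbove j y → lookup (σ y) c ≡ d
  σ-at-c {y} y-fix = trans (lookup-swapPos c d y c) (trans (cong (lookup y) (transp-left c d)) (fixesAt y-fix d j<d))

  σ-at-d : ∀ y → lookup (σ y) d ≡ lookup y c
  σ-at-d y = trans (lookup-swapPos c d y d) (cong (lookup y) (transp-right c d))

  y-at-c<d : ∀ {y} → Perm y → FixesAbove j y → toℕ (lookup y c) < toℕ d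
  y-at-c<d {y} y-perm y-fix = subst (toℕ (lookup y c) <_) (sym toℕ-d) (s≤s (value-below y-perm y-fix c (≤-reflexive toℕ-c)))

  σ-moves : ∀ {y} → Perm y → FixesAbove j y → ¬ FixesAbove j (σ y)
  σ-moves {y} y-perm y-fix σy-fix =
    <-irrefl (cong toℕ (trans (sym (σ-at-d y)) (fixesAt σy-fix d j<d))) (y-at-c<d y-perm y-fix)

  d≡suc-c : toℕ d ≡ suc (toℕ c)
  d≡suc-c = trans toℕ-d (cong suc (sym toℕ-c))

  ℓ-σ : ∀ {y} → Perm y → FixesAbove j y → ℓ (σ y) ≡ suc (ℓ y)
  ℓ-σ {y} y-perm y-fix = trans
    (ℓ-transpose-adjacentPositions (swapPos-perm c d y-perm) c d d≡suc-c
      (subst₂ (λ s t → toℕ s < toℕ t) (sym (σ-at-d y)) (sym (σ-at-c y-fix)) (y-at-c<d y-perm y-fix)))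
    (cong (suc ∘ ℓ) (trans (sym (swapPos≡tmul c d (swapPos-perm c d y-perm))) (swapPos-involutive c d y)))

  σ-⋖ : ∀ {y} → Perm y → FixesAbove j y → y ⋖ σ y
  σ-⋖ {y} y-perm y-fix = record
    { a = lookup y c ; b = lookup y d ; a≢b = c≢d ∘ lookup-injective y-perm c d
    ; x≡tmul = swapPos≡tmul c d y-perm ; ℓ≡suc = ℓ-σ y-perm y-fix }

  σ-mono : ∀ {y y′} → Perm y → FixesAbove j y → Perm y′ → FixesAbove j y′ → y ⋖ y′ → σ y ⋖ σ y′
  σ-mono {y} {y′} y-perm y-fix y′-perm y′-fix cov = record
    { a = ⋖.a cov ; b = ⋖.b cov ; a≢b = ⋖.a≢b cov
    ; x≡tmul = trans (cong σ (⋖.x≡tmul cov)) (swapPos-tmul c d _ _ y)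
    ; ℓ≡suc = trans (ℓ-σ y′-perm y′-fix) (cong suc (trans (⋖.ℓ≡suc cov) (sym (ℓ-σ y-perm y-fix)))) }

  module RightLift {y v : Word (suc m)} (y-perm : Perm y) (y-fix : FixesAbove j y) (v-perm : Perm v)
                   (cov : v ⋖ σ y) where
    private
      x = σ y
      e = lookup y c
      x-perm : Perm x
      x-perm = swapPos-perm c d y-perm
      x-fix : FixesAbove (suc j) x
      x-fix = σ-fixesAbove y-fix
      xc≡d : lookup x c ≡ d
      xc≡d = σ-at-c y-fix
      xd≡e : lookup x d ≡ e
      xd≡e = σ-at-d y
      e<d : toℕ e < toℕ d
      e<d = y-at-c<d y-perm y-fix
      e≢d : e ≢ d
      e≢d e≡d = <-irrefl (cong toℕ e≡d) e<d
      ℓv≡ℓy : ℓ v ≡ ℓ y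
      ℓv≡ℓy = suc-injective (trans (sym (⋖.ℓ≡suc cov)) (ℓ-σ y-perm y-fix))
      σv≡ : (k : v ⋖ x) → σ v ≡ tmul (⋖.a k) (⋖.b k) y
      σv≡ k = trans (cong σ (⋖-back k))
        (trans (swapPos-tmul c d (⋖.a k) (⋖.b k) x) (cong (tmul (⋖.a k) (⋖.b k)) (swapPos-involutive c d y)))

    descends : (k : v ⋖ x) → lookup v c ≡ d → toℕ (lookup v d) < toℕ d → σ v ⋖ y × ¬ FixesAbove j v
    descends k vc≡d vd<d = σv⋖y , v-moves
      where
      σv⋖y : σ v ⋖ y
      σv⋖y = record
        { a = ⋖.a k ; b = ⋖.b k ; a≢b = ⋖.a≢b k
        ; x≡tmul = sym (trans (cong (tmul (⋖.a k) (⋖.b k)) (σv≡ k)) (tmul-involutive (⋖.a k) (⋖.b k) y))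
        ; ℓ≡suc = trans (sym ℓv≡ℓy) (trans
            (ℓ-transpose-adjacentPositions v-perm c d d≡suc-c (subst (toℕ (lookup v d) <_) (cong toℕ (sym vc≡d)) vd<d))
            (cong (suc ∘ ℓ) (sym (swapPos≡tmul c d v-perm)))) }
      v-moves : ¬ FixesAbove j v
      v-moves v-fix = <-irrefl (cong toℕ (fixesAt v-fix d j<d)) vd<d

    same-transposition : (k : v ⋖ x) → ⋖.a k ≡ e → ⋖.b k ≡ d → v ≡ y
    same-transposition k a≡e b≡d = begin
      v                                   ≡⟨ ⋖-back k ⟩
      tmul (⋖.a k) (⋖.b k) x              ≡⟨ cong₂ (λ s t → tmul s t x) a≡e b≡d ⟩
      tmul e d x                          ≡⟨ tmul-comm e d x ⟩
      tmul d e x                          ≡⟨ cong₂ (λ s t → tmul s t x) (sym xc≡d) (sym xd≡e) ⟩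
      tmul (lookup x c) (lookup x d) x    ≡⟨ swapPos≡tmul c d x-perm ⟨
      swapPos c d x                       ≡⟨ swapPos-involutive c d y ⟩
      y                                   ∎
      where open ≡-Reasoning

    d-and-other-impossible : (k : v ⋖ x) → ⋖.a k ≡ d → ⋖.b k ≢ e → ⋖.b k ≢ d → ⊥
    d-and-other-impossible k a≡d b≢e b≢d with preimage x-perm (⋖.b k)
    ... | r , xr≡b with <-cmp (toℕ c) (toℕ r)
    ... | tri≈ _ c≡r _ = b≢d (trans (sym xr≡b) (trans (cong (lookup x) (sym (toℕ-injective c≡r))) xc≡d))
    ... | tri< c<r _ _ = <-irrefl refl (<-trans b<sj (subst (suc j <_) (cong toℕ r≡b) sj<r))
      where
      b<sj : toℕ (⋖.b k) < suc j
      b<sj = subst (toℕ (⋖.b k) <_) (trans (cong toℕ a≡d) toℕ-d)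
        (⋖-direction v-perm k c r (trans xc≡d (sym a≡d)) xr≡b c<r)
      sj<r : suc j < toℕ r
      sj<r = above⇒above-d (subst (_< toℕ r) toℕ-c c<r)
        (λ r≡d → b≢e (trans (sym xr≡b) (trans (cong (lookup x) r≡d) xd≡e)))
      r≡b : r ≡ ⋖.b k
      r≡b = fixed-position x-fix r xr≡b sj<r
    ... | tri> _ _ r<c = <-irrefl refl (<-trans (subst (_< toℕ c) (cong toℕ r≡b) r<c)
                                               (subst (_< toℕ (⋖.b k)) (sym toℕ-c) (<-trans (n<1+n j) sj<b)))
      where
      a<b : toℕ (⋖.a k) < toℕ (⋖.b k)
      a<b = ⋖-direction v-perm (⋖-flip k) r c xr≡b (trans xc≡d (sym a≡d)) r<c
      sj<b : suc j < toℕ (⋖.b k)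
      sj<b = subst (_< toℕ (⋖.b k)) (trans (cong toℕ a≡d) toℕ-d) a<b
      r≡b : r ≡ ⋖.b k
      r≡b = fixed-value x-perm x-fix r xr≡b sj<b

    e-and-other : (k : v ⋖ x) → ⋖.a k ≡ e → ⋖.b k ≢ e → ⋖.b k ≢ d → σ v ⋖ y × ¬ FixesAbove j v
    e-and-other k a≡e b≢e b≢d with preimage x-perm (⋖.b k)
    ... | r , xr≡b with <-cmp (toℕ d) (toℕ r)
    ... | tri≈ _ d≡r _ = ⊥-elim (b≢e (trans (sym xr≡b) (trans (cong (lookup x) (sym (toℕ-injective d≡r))) xd≡e)))
    ... | tri< d<r _ _ = ⊥-elim (<-irrefl refl (<-trans b<e
          (≤-<-trans (value-below y-perm y-fix c (≤-reflexive toℕ-c))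
            (<-trans (n<1+n j) (subst (suc j <_) (cong toℕ r≡b) sj<r)))))
      where
      b<e : toℕ (⋖.b k) < toℕ e
      b<e = subst (toℕ (⋖.b k) <_) (cong toℕ a≡e) (⋖-direction v-perm k d r (trans xd≡e (sym a≡e)) xr≡b d<r)
      sj<r : suc j < toℕ r
      sj<r = subst (_< toℕ r) toℕ-d d<r
      r≡b : r ≡ ⋖.b k
      r≡b = fixed-position x-fix r xr≡b sj<r
    ... | tri> _ _ r<d = descends k vc≡d vd<d
      where
      vc≡d : lookup v c ≡ d
      vc≡d = trans (⋖-lookup-other k c (λ xc≡a → e≢d (trans (sym a≡e) (trans (sym xc≡a) xc≡d)))
                                       (λ xc≡b → b≢d (trans (sym xc≡b) xc≡d))) xc≡d
      vd<d : toℕ (lookup v d) < toℕ d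
      vd<d with <-cmp (toℕ (⋖.b k)) (toℕ d)
      ... | tri< b<d _ _ = subst (_< toℕ d) (cong toℕ (sym (⋖-lookup-a k d (trans xd≡e (sym a≡e))))) b<d
      ... | tri≈ _ b≡d _ = ⊥-elim (b≢d (toℕ-injective b≡d))
      ... | tri> _ _ d<b = ⊥-elim (<-irrefl refl (<-trans (subst (_< toℕ d) (cong toℕ r≡b) r<d) d<b))
        where
        r≡b : r ≡ ⋖.b k
        r≡b = fixed-value x-perm x-fix r xr≡b (subst (_< toℕ (⋖.b k)) toℕ-d d<b)

    disjoint : ⋖.a cov ≢ e → ⋖.a cov ≢ d → ⋖.b cov ≢ e → ⋖.b cov ≢ d → σ v ⋖ y × ¬ FixesAbove j v
    disjoint a≢e a≢d b≢e b≢d = descends cov vc≡d (subst (_< toℕ d) (cong toℕ (sym vd≡e)) e<d)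
      where
      vc≡d : lookup v c ≡ d
      vc≡d = trans (⋖-lookup-other cov c (λ xc≡a → a≢d (trans (sym xc≡a) xc≡d))
        (λ xc≡b → b≢d (trans (sym xc≡b) xc≡d))) xc≡d
      vd≡e : lookup v d ≡ e
      vd≡e = trans (⋖-lookup-other cov d (λ xd≡a → a≢e (trans (sym xd≡a) xd≡e))
        (λ xd≡b → b≢e (trans (sym xd≡b) xd≡e))) xd≡e

    by-cases : TranspCase e d (⋖.a cov) → TranspCase e d (⋖.b cov) → v ≡ y ⊎ (σ v ⋖ y × ¬ FixesAbove j v)
    by-cases (is-left a≡e) (is-left b≡e) = ⊥-elim (⋖.a≢b cov (trans a≡e (sym b≡e)))
    by-cases (is-left a≡e) (is-right b≡d _) = inj₁ (same-transposition cov a≡e b≡d)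
    by-cases (is-left a≡e) (is-other b≢e b≢d) = inj₂ (e-and-other cov a≡e b≢e b≢d)
    by-cases (is-right a≡d _) (is-left b≡e) = inj₁ (same-transposition (⋖-flip cov) b≡e a≡d)
    by-cases (is-right a≡d _) (is-right b≡d _) = ⊥-elim (⋖.a≢b cov (trans a≡d (sym b≡d)))
    by-cases (is-right a≡d _) (is-other b≢e b≢d) = ⊥-elim (d-and-other-impossible cov a≡d b≢e b≢d)
    by-cases (is-other a≢e a≢d) (is-left b≡e) = inj₂ (e-and-other (⋖-flip cov) b≡e a≢e a≢d)
    by-cases (is-other a≢e a≢d) (is-right b≡d _) = ⊥-elim (d-and-other-impossible (⋖-flip cov) b≡d a≢e a≢d)
    by-cases (is-other a≢e a≢d) (is-other b≢e b≢d) = inj₂ (disjoint a≢e a≢d b≢e b≢d)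

  rightMultiplication : SideMultiplication {suc m} j
  rightMultiplication = record
    { σ = σ
    ; σ-involutive = swapPos-involutive c d
    ; σ-perm = swapPos-perm c d
    ; σ-fixesAbove = λ _ → σ-fixesAbove
    ; σ-moves = σ-moves
    ; σ-⋖ = σ-⋖
    ; σ-mono = σ-mono
    ; σ-lift = λ {y} y-perm y-fix v-perm cov →
        RightLift.by-cases y-perm y-fix v-perm cov (transpCase (lookup y c) d _) (transpCase (lookup y c) d _) }

record BooleanIdeal {n : ℕ} (w : Word n) (r : ℕ) : Set where
  field
    f : Word n → Subset r
    g : Subset r → Word n
    g-perm : ∀ s → Perm (g s)
    g-≼ : ∀ s → g s ≼ w
    f∘g : ∀ s → f (g s) ≡ s
    g∘f : ∀ {v} → Perm v → v ≼ w → g (f v) ≡ v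
    f-mono : ∀ {v v′} → Perm v → v ≼ w → Perm v′ → v′ ≼ w → v ≼ v′ → f v ⊆ f v′
    f-reflect : ∀ {v v′} → Perm v → v ≼ w → Perm v′ → v′ ≼ w → f v ⊆ f v′ → v ≼ v′

∷-⊆ : ∀ {r} {x y : Bool} {s t : Subset r} → (x ≡ inside → y ≡ inside) → s ⊆ t → (x ∷ s) ⊆ (y ∷ t)
∷-⊆ x⇒y s⊆t here rewrite x⇒y refl = here
∷-⊆ x⇒y s⊆t (there i∈s) = there (s⊆t i∈s)

∷-⊆-head : ∀ {r} {x y : Bool} {s t : Subset r} → (x ∷ s) ⊆ (y ∷ t) → x ≡ inside → y ≡ inside
∷-⊆-head {y = true} _ _ = refl
∷-⊆-head {y = false} x∷s⊆y∷t refl with x∷s⊆y∷t here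
... | ()

-- A permutation v below σ w either lies below w, or fails to fix position j + 1
-- and σ v lies below w; recording which case occurs adds one coordinate to B(w).
module Extend {n j : ℕ} (M : SideMultiplication {n} j) (d : Fin n) (toℕ-d : toℕ d ≡ suc j) where
  open SideMultiplication M

  private
    j<d : j < toℕ d
    j<d = subst (j <_) (sym toℕ-d) ≤-refl

  project : Word n → Word n
  project v = if ⌊ lookup v d ≟ d ⌋ then v else σ v

  bit : Word n → Bool
  bit v = if ⌊ lookup v d ≟ d ⌋ then outside else inside

  project-fixed : ∀ {v} → FixesAbove j v → project v ≡ v
  project-fixed {v} v-fix with lookup v d ≟ d
  ... | yes _ = refl
  ... | no vd≢d = contradiction (fixesAt v-fix d j<d) vd≢d

  bit-fixed : ∀ {v} → FixesAbove j v → bit v ≡ outside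
  bit-fixed {v} v-fix with lookup v d ≟ d
  ... | yes _ = refl
  ... | no vd≢d = contradiction (fixesAt v-fix d j<d) vd≢d

  project-moved : ∀ {v} → FixesAbove (suc j) v → ¬ FixesAbove j v → project v ≡ σ v
  project-moved {v} v-fix v-moves with lookup v d ≟ d
  ... | yes vd≡d = contradiction (fixesAbove-pred d toℕ-d v-fix vd≡d) v-moves
  ... | no _ = refl

  bit-moved : ∀ {v} → FixesAbove (suc j) v → ¬ FixesAbove j v → bit v ≡ inside
  bit-moved {v} v-fix v-moves with lookup v d ≟ d
  ... | yes vd≡d = contradiction (fixesAbove-pred d toℕ-d v-fix vd≡d) v-moves
  ... | no _ = refl

  bit-inside⇒moved : ∀ {v} → bit v ≡ inside → ¬ FixesAbove j v
  bit-inside⇒moved bit≡inside v-fix with trans (sym bit≡inside) (bit-fixed v-fix)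
  ... | ()

  σ-mono-≼ : ∀ {y y′} → Perm y → FixesAbove j y′ → y ≼ y′ → σ y ≼ σ y′
  σ-mono-≼ y-perm y′-fix ε = ε
  σ-mono-≼ y-perm y′-fix (cov ◅ s) = σ-mono y-perm (fixesAbove-⋖ y-perm cov x-fix) x-perm x-fix cov
    ◅ σ-mono-≼ x-perm y′-fix s
    where
    x-perm = ⋖-perm y-perm cov
    x-fix = fixesAbove-≼ x-perm s y′-fix

  module _ {w : Word n} (w-perm : Perm w) (w-fix : FixesAbove j w) where
    private
      u = σ w

    ≼σ-fixesAbove : ∀ {v} → Perm v → v ≼ u → FixesAbove (suc j) v
    ≼σ-fixesAbove v-perm s = fixesAbove-≼ v-perm s (σ-fixesAbove w-perm w-fix)

    ≼σ-cases : ∀ {v} → Perm v → v ≼ u → (FixesAbove j v × v ≼ w) ⊎ (¬ FixesAbove j v × σ v ≼ w)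
    ≼σ-cases v-perm ε = inj₂ (σ-moves w-perm w-fix , subst (_≼ w) (sym (σ-involutive w)) ε)
    ≼σ-cases {v} v-perm (_◅_ {j = x} cov s) with ≼σ-cases (⋖-perm v-perm cov) s
    ... | inj₁ (x-fix , x≼w) = inj₁ (fixesAbove-⋖ v-perm cov x-fix , cov ◅ x≼w)
    ... | inj₂ (_ , σx≼w) with σ-lift σx-perm σx-fix v-perm (subst (v ⋖_) (sym (σ-involutive x)) cov)
      where
      σx-perm = σ-perm (⋖-perm v-perm cov)
      σx-fix = fixesAbove-≼ σx-perm σx≼w w-fix
    ...   | inj₁ refl = inj₁ (fixesAbove-≼ (σ-perm (⋖-perm v-perm cov)) σx≼w w-fix , σx≼w)
    ...   | inj₂ (σv⋖σx , v-moves) = inj₂ (v-moves , σv⋖σx ◅ σx≼w)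

    project-≼ : ∀ {v} → Perm v → v ≼ u → Perm (project v) × project v ≼ w
    project-≼ {v} v-perm s with ≼σ-cases v-perm s
    ... | inj₁ (v-fix , v≼w) = subst (λ t → Perm t × t ≼ w) (sym (project-fixed v-fix)) (v-perm , v≼w)
    ... | inj₂ (v-moves , σv≼w) =
      subst (λ t → Perm t × t ≼ w) (sym (project-moved (≼σ-fixesAbove v-perm s) v-moves)) (σ-perm v-perm , σv≼w)

    project-⋖ : ∀ {z z′} → Perm z → z′ ≼ u → z ⋖ z′ → project z ≼ project z′
    project-⋖ {z} {z′} z-perm s′ cov with ≼σ-cases (⋖-perm z-perm cov) s′
    ... | inj₁ (z′-fix , _) =
      subst₂ _≼_ (sym (project-fixed (fixesAbove-⋖ z-perm cov z′-fix))) (sym (project-fixed z′-fix)) (cov ◅ ε)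
    ... | inj₂ (z′-moves , σz′≼w)
      with σ-lift σz′-perm (fixesAbove-≼ σz′-perm σz′≼w w-fix) z-perm (subst (z ⋖_) (sym (σ-involutive z′)) cov)
      where σz′-perm = σ-perm (⋖-perm z-perm cov)
    ...   | inj₁ z≡σz′ = subst₂ _≼_
            (sym (trans (project-fixed (subst (FixesAbove j) (sym z≡σz′)
              (fixesAbove-≼ (σ-perm (⋖-perm z-perm cov)) σz′≼w w-fix)))
              z≡σz′))
            (sym (project-moved (≼σ-fixesAbove (⋖-perm z-perm cov) s′) z′-moves)) ε
    ...   | inj₂ (σz⋖σz′ , z-moves) = subst₂ _≼_
            (sym (project-moved (≼σ-fixesAbove z-perm (cov ◅ s′)) z-moves))
            (sym (project-moved (≼σ-fixesAbove (⋖-perm z-perm cov) s′) z′-moves)) (σz⋖σz′ ◅ ε)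

    project-mono : ∀ {v v′} → Perm v → v′ ≼ u → v ≼ v′ → project v ≼ project v′
    project-mono v-perm s′ ε = ε
    project-mono v-perm s′ (cov ◅ s) = project-⋖ v-perm (s ◅◅ s′) cov ◅◅ project-mono (⋖-perm v-perm cov) s′ s

    project-reflect : ∀ {v v′} → Perm v → v ≼ u → Perm v′ → v′ ≼ u →
      (FixesAbove j v′ → FixesAbove j v) → project v ≼ project v′ → v ≼ v′
    project-reflect {v} {v′} v-perm s v′-perm s′ fix⇒fix le with ≼σ-cases v-perm s | ≼σ-cases v′-perm s′
    ... | inj₁ (v-fix , _) | inj₁ (v′-fix , _) = subst₂ _≼_ (project-fixed v-fix) (project-fixed v′-fix) le
    ... | inj₁ (v-fix , _) | inj₂ (v′-moves , σv′≼w) =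
      subst₂ _≼_ (project-fixed v-fix) (project-moved (≼σ-fixesAbove v′-perm s′) v′-moves) le
        ◅ʳ subst (σ v′ ⋖_) (σ-involutive v′)
          (σ-⋖ (σ-perm v′-perm) (fixesAbove-≼ (σ-perm v′-perm) σv′≼w w-fix))
    ... | inj₂ (v-moves , _) | inj₁ (v′-fix , _) = ⊥-elim (v-moves (fix⇒fix v′-fix))
    ... | inj₂ (v-moves , _) | inj₂ (v′-moves , σv′≼w) = subst₂ _≼_ (σ-involutive v) (σ-involutive v′)
      (σ-mono-≼ (σ-perm v-perm) (fixesAbove-≼ (σ-perm v′-perm) σv′≼w w-fix)
        (subst₂ _≼_ (project-moved (≼σ-fixesAbove v-perm s) v-moves)
          (project-moved (≼σ-fixesAbove v′-perm s′) v′-moves) le))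

    booleanIdeal-σ : ∀ {r} → BooleanIdeal w r → BooleanIdeal (σ w) (suc r)
    booleanIdeal-σ {r} B = record
      { f = f′ ; g = g′ ; g-perm = g′-perm ; g-≼ = g′-≼ ; f∘g = f′∘g′ ; g∘f = g′∘f′
      ; f-mono = f′-mono ; f-reflect = f′-reflect }
      where
      open BooleanIdeal B
      f′ : Word n → Subset (suc r)
      f′ v = bit v ∷ f (project v)
      g′ : Subset (suc r) → Word n
      g′ (true ∷ s) = σ (g s)
      g′ (false ∷ s) = g s
      g′-perm : ∀ s → Perm (g′ s)
      g′-perm (true ∷ s) = σ-perm (g-perm s)
      g′-perm (false ∷ s) = g-perm s
      gs-fix : ∀ s → FixesAbove j (g s)
      gs-fix s = fixesAbove-≼ (g-perm s) (g-≼ s) w-fix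
      g′-≼ : ∀ s → g′ s ≼ σ w
      g′-≼ (true ∷ s) = σ-mono-≼ (g-perm s) w-fix (g-≼ s)
      g′-≼ (false ∷ s) = g-≼ s ◅ʳ σ-⋖ w-perm w-fix
      f′∘g′ : ∀ s → f′ (g′ s) ≡ s
      f′∘g′ (false ∷ s) = cong₂ _∷_ (bit-fixed (gs-fix s)) (trans (cong f (project-fixed (gs-fix s))) (f∘g s))
      f′∘g′ (true ∷ s) = cong₂ _∷_ (bit-moved σgs-fix σgs-moves)
        (trans (cong f (trans (project-moved σgs-fix σgs-moves) (σ-involutive (g s)))) (f∘g s))
        where
        σgs-fix = σ-fixesAbove (g-perm s) (gs-fix s)
        σgs-moves = σ-moves (g-perm s) (gs-fix s)
      g′∘f′ : ∀ {v} → Perm v → v ≼ σ w → g′ (f′ v) ≡ v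
      g′∘f′ {v} v-perm s with ≼σ-cases v-perm s
      ... | inj₁ (v-fix , v≼w) rewrite bit-fixed v-fix | project-fixed v-fix = g∘f v-perm v≼w
      ... | inj₂ (v-moves , σv≼w)
        rewrite bit-moved (≼σ-fixesAbove v-perm s) v-moves | project-moved (≼σ-fixesAbove v-perm s) v-moves =
        trans (cong σ (g∘f (σ-perm v-perm) σv≼w)) (σ-involutive v)
      f′-mono : ∀ {v v′} → Perm v → v ≼ σ w → Perm v′ → v′ ≼ σ w → v ≼ v′ → f′ v ⊆ f′ v′
      f′-mono {v} {v′} v-perm s v′-perm s′ v≼v′ = ∷-⊆ bit-mono
        (f-mono (proj₁ (project-≼ v-perm s)) (proj₂ (project-≼ v-perm s))
                (proj₁ (project-≼ v′-perm s′)) (proj₂ (project-≼ v′-perm s′)) (project-mono v-perm s′ v≼v′))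
        where
        bit-mono : bit v ≡ inside → bit v′ ≡ inside
        bit-mono bit≡inside with ≼σ-cases v′-perm s′
        ... | inj₁ (v′-fix , _) = ⊥-elim (bit-inside⇒moved bit≡inside (fixesAbove-≼ v-perm v≼v′ v′-fix))
        ... | inj₂ (v′-moves , _) = bit-moved (≼σ-fixesAbove v′-perm s′) v′-moves
      f′-reflect : ∀ {v v′} → Perm v → v ≼ σ w → Perm v′ → v′ ≼ σ w → f′ v ⊆ f′ v′ → v ≼ v′
      f′-reflect {v} {v′} v-perm s v′-perm s′ f′v⊆f′v′ = project-reflect v-perm s v′-perm s′ fix⇒fix
        (f-reflect (proj₁ (project-≼ v-perm s)) (proj₂ (project-≼ v-perm s))
                   (proj₁ (project-≼ v′-perm s′)) (proj₂ (project-≼ v′-perm s′)) (drop-∷-⊆ f′v⊆f′v′))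
        where
        fix⇒fix : FixesAbove j v′ → FixesAbove j v
        fix⇒fix v′-fix with lookup v d ≟ d
        ... | yes vd≡d = fixesAbove-pred d toℕ-d (≼σ-fixesAbove v-perm s) vd≡d
        ... | no _ = ⊥-elim (bit-inside⇒moved (∷-⊆-head f′v⊆f′v′ refl) v′-fix)

module _ {n : ℕ} where

  identity : Word n
  identity = V.tabulate (λ i → i)

  lookup-identity : ∀ i → lookup identity i ≡ i
  lookup-identity = lookup∘tabulate (λ i → i)

  identity-perm : Perm identity
  identity-perm = perm λ i j eq → trans (sym (lookup-identity i)) (trans eq (lookup-identity j))

  identity-fixesAbove : ∀ k → FixesAbove k identity
  identity-fixesAbove k = fixesAbove λ q _ → lookup-identity q

  ℓ-identity : ℓ identity ≡ 0
  ℓ-identity = trans (ℓ≡len identity) (sum-zero {xs = allFin n} (λ i → sum-zero {xs = allFin n} (no-inversion i)))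
    where
    sum-zero : ∀ {A : Set} {h : A → ℕ} {xs : List A} → (∀ x → h x ≡ 0) → sum (L.map h xs) ≡ 0
    sum-zero {xs = []} _ = refl
    sum-zero {xs = x ∷ xs} h≡0 rewrite h≡0 x = sum-zero {xs = xs} h≡0
    no-inversion : ∀ i j → invertedPair identity i j ≡ 0
    no-inversion i j rewrite lookup-identity i | lookup-identity j with toℕ i <? toℕ j | toℕ j <? toℕ i
    ... | yes i<j | yes j<i = contradiction (<-trans i<j j<i) (<-irrefl refl)
    ... | yes _ | no _ = refl
    ... | no _ | _ = refl

  ≼identity⇒≡ : ∀ {v} → v ≼ identity → v ≡ identity
  ≼identity⇒≡ ε = refl
  ≼identity⇒≡ {v} (cov ◅ s) = contradiction (subst (ℓ v <_) ℓ-identity (ℓ-⋖◅≼ cov s)) λ ()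

  booleanIdeal-identity : BooleanIdeal identity 0
  booleanIdeal-identity = record
    { f = λ _ → []
    ; g = λ _ → identity
    ; g-perm = λ _ → identity-perm
    ; g-≼ = λ _ → ε
    ; f∘g = λ { [] → refl }
    ; g∘f = λ _ s → sym (≼identity⇒≡ s)
    ; f-mono = λ _ _ _ _ _ {i} _ → ⊥-elim (FP.¬Fin0 i)
    ; f-reflect = λ _ s _ s′ _ → subst₂ _≼_ (sym (≼identity⇒≡ s)) (sym (≼identity⇒≡ s′)) ε }

booleanIdeal⇒IsBooleanB : ∀ {n} {w : Word n} {r} → BooleanIdeal w r → IsBooleanB w
booleanIdeal⇒IsBooleanB {r = r} B = r , f , g , (λ s → lookup-injective (g-perm s) , ≼→≤B (g-≼ s)) , f∘g ,
  (λ v (v-perm , v≤w) → g∘f (perm v-perm) (≤B→≼ v≤w)) ,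
  (λ v v′ (v-perm , v≤w) (v′-perm , v′≤w) →
     (λ v≤v′ → f-mono (perm v-perm) (≤B→≼ v≤w) (perm v′-perm) (≤B→≼ v′≤w) (≤B→≼ v≤v′)) ,
     (λ fv⊆fv′ → ≼→≤B (f-reflect (perm v-perm) (≤B→≼ v≤w) (perm v′-perm) (≤B→≼ v′≤w) fv⊆fv′)))
  where open BooleanIdeal B

IsBooleanB⇒booleanIdeal : ∀ {n} {w : Word n} → IsBooleanB w → Σ ℕ (BooleanIdeal w)
IsBooleanB⇒booleanIdeal (r , f , g , g-in , f∘g , g∘f , order) = r , record
  { f = f
  ; g = g
  ; g-perm = λ s → perm (proj₁ (g-in s))
  ; g-≼ = λ s → ≤B→≼ (proj₂ (g-in s))
  ; f∘g = f∘g
  ; g∘f = λ {v} v-perm v≼w → g∘f v (lookup-injective v-perm , ≼→≤B v≼w)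
  ; f-mono = λ {v} {v′} v-perm v≼w v′-perm v′≼w v≼v′ →
      proj₁ (order v v′ (lookup-injective v-perm , ≼→≤B v≼w)
        (lookup-injective v′-perm , ≼→≤B v′≼w)) (≼→≤B v≼v′)
  ; f-reflect = λ {v} {v′} v-perm v≼w v′-perm v′≼w fv⊆fv′ →
      ≤B→≼ (proj₂ (order v v′ (lookup-injective v-perm , ≼→≤B v≼w)
        (lookup-injective v′-perm , ≼→≤B v′≼w)) fv⊆fv′) }

bit→ℕ : Bool → ℕ
bit→ℕ true = 1
bit→ℕ false = 0

count : (ℕ → Bool) → ℕ → ℕ
count P zero = 0
count P (suc k) = count P k + bit→ℕ (P k)

bit→ℕ-mono : ∀ {x y : Bool} → (x ≡ true → y ≡ true) → bit→ℕ x ≤ bit→ℕ y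
bit→ℕ-mono {false} _ = z≤n
bit→ℕ-mono {true} x⇒y rewrite x⇒y refl = ≤-refl

bit→ℕ≤1 : ∀ x → bit→ℕ x ≤ 1
bit→ℕ≤1 true = ≤-refl
bit→ℕ≤1 false = z≤n

count-mono : ∀ {P Q : ℕ → Bool} k → (∀ i → i < k → P i ≡ true → Q i ≡ true) → count P k ≤ count Q k
count-mono zero _ = z≤n
count-mono (suc k) P⇒Q = +-mono-≤ (count-mono k (λ i i<k → P⇒Q i (≤-trans i<k (n≤1+n k))))
  (bit→ℕ-mono (P⇒Q k ≤-refl))

count-mono-except : ∀ {P Q : ℕ → Bool} k i₀ → (∀ i → i < k → i ≢ i₀ → P i ≡ true → Q i ≡ true) →
  count P k ≤ suc (count Q k)
count-mono-except zero _ _ = z≤n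
count-mono-except {P} {Q} (suc k) i₀ P⇒Q with k ℕ.≟ i₀
... | yes refl = begin
  count P k + bit→ℕ (P k)     ≤⟨ +-mono-≤ (count-mono k (λ i i<k → P⇒Q i (≤-trans i<k (n≤1+n k)) (<⇒≢ i<k))) (bit→ℕ≤1 (P k)) ⟩
  count Q k + 1               ≡⟨ +-comm (count Q k) 1 ⟩
  suc (count Q k)             ≤⟨ s≤s (m≤m+n (count Q k) _) ⟩
  suc (count Q (suc k))       ∎
  where open ≤-Reasoning
... | no k≢i₀ = +-mono-≤ (count-mono-except k i₀ (λ i i<k → P⇒Q i (≤-trans i<k (n≤1+n k))))
    (bit→ℕ-mono (P⇒Q k ≤-refl k≢i₀))

count-zero : ∀ {P : ℕ → Bool} k → (∀ i → i < k → P i ≡ false) → count P k ≡ 0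
count-zero zero _ = refl
count-zero {P} (suc k) P≡false rewrite P≡false k ≤-refl
  | count-zero k (λ i i<k → P≡false i (≤-trans i<k (n≤1+n k))) = refl

injection⇒≤count : ∀ {P : ℕ → Bool} k r (h : Fin r → ℕ) → (∀ a b → h a ≡ h b → a ≡ b) →
  (∀ a → h a < k) →
  (∀ a → P (h a) ≡ true) → r ≤ count P k
injection⇒≤count zero zero _ _ _ _ = z≤n
injection⇒≤count zero (suc r) h _ h<0 _ = contradiction (h<0 fzero) n≮0
injection⇒≤count {P} (suc k) r h h-inj h<sk P∘h with FP.any? (λ a → h a ℕ.≟ k)
... | no miss = ≤-trans (injection⇒≤count k r h h-inj (λ a → ≤∧≢⇒< (≤-pred (h<sk a)) (miss ∘ (a ,_)))
    P∘h) (m≤m+n _ _)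
... | yes (a₀ , ha₀≡k) = remove-hit r h h-inj h<sk P∘h a₀ ha₀≡k
  where
  remove-hit : ∀ r (h : Fin r → ℕ) → (∀ a b → h a ≡ h b → a ≡ b) → (∀ a → h a < suc k) →
    (∀ a → P (h a) ≡ true) → (a₀ : Fin r) → h a₀ ≡ k → r ≤ count P (suc k)
  remove-hit (suc r) h h-inj h<sk P∘h a₀ ha₀≡k =
    subst (_≤ count P k + bit→ℕ (P k)) (+-comm r 1)
      (+-mono-≤ (injection⇒≤count k r h′ h′-inj h′<k (P∘h ∘ F.punchIn a₀))
                (≤-reflexive (sym (cong bit→ℕ (trans (cong P (sym ha₀≡k)) (P∘h a₀))))))
    where
    h′ : Fin r → ℕ
    h′ = h ∘ F.punchIn a₀
    h′-inj : ∀ a b → h′ a ≡ h′ b → a ≡ b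
    h′-inj a b eq = FP.punchIn-injective a₀ a b (h-inj _ _ eq)
    h′<k : ∀ b → h′ b < k
    h′<k b = ≤∧≢⇒< (≤-pred (h<sk (F.punchIn a₀ b)))
      (λ eq → FP.punchInᵢ≢i a₀ b (h-inj _ _ (trans eq (sym ha₀≡k))))

p⊆q∧p≢q⇒∣p∣<∣q∣ : ∀ {k} (p q : Subset k) → p ⊆ q → p ≢ q → ∣ p ∣ < ∣ q ∣
p⊆q∧p≢q⇒∣p∣<∣q∣ [] [] _ p≢q = contradiction refl p≢q
p⊆q∧p≢q⇒∣p∣<∣q∣ (outside ∷ p) (outside ∷ q) p⊆q p≢q = p⊆q∧p≢q⇒∣p∣<∣q∣ p q (drop-∷-⊆ p⊆q)
  (p≢q ∘ cong (outside ∷_))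
p⊆q∧p≢q⇒∣p∣<∣q∣ (outside ∷ p) (inside ∷ q) p⊆q _ = s≤s (p⊆q⇒∣p∣≤∣q∣ (drop-∷-⊆ p⊆q))
p⊆q∧p≢q⇒∣p∣<∣q∣ (inside ∷ p) (outside ∷ q) p⊆q _ with p⊆q here
... | ()
p⊆q∧p≢q⇒∣p∣<∣q∣ (inside ∷ p) (inside ∷ q) p⊆q p≢q = s≤s (p⊆q∧p≢q⇒∣p∣<∣q∣ p q (drop-∷-⊆ p⊆q)
  (p≢q ∘ cong (inside ∷_)))

-- A code lists, from its top index j = length − 1 down to 0, whether the simple
-- reflection s_j is absent or multiplies the word built from the lower letters on
-- the left or on the right. When s_(j-1) is absent both sides give the same word,
-- so a valid code only uses the right side right above a present letter.
data Letter : Set where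
  skip onLeft onRight : Letter

weight : List Letter → ℕ
weight [] = 0
weight (skip ∷ cs) = weight cs
weight (onLeft ∷ cs) = suc (weight cs)
weight (onRight ∷ cs) = suc (weight cs)

StartsPresent : List Letter → Set
StartsPresent [] = ⊥
StartsPresent (skip ∷ _) = ⊥
StartsPresent (onLeft ∷ _) = ⊤
StartsPresent (onRight ∷ _) = ⊤

startsPresent? : ∀ cs → Dec (StartsPresent cs)
startsPresent? [] = no λ ()
startsPresent? (skip ∷ _) = no λ ()
startsPresent? (onLeft ∷ _) = yes tt
startsPresent? (onRight ∷ _) = yes tt

Valid : List Letter → Set
Valid [] = ⊤
Valid (skip ∷ cs) = Valid cs
Valid (onLeft ∷ cs) = Valid cs
Valid (onRight ∷ cs) = Valid cs × StartsPresent cs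

sumTo : ℕ → (ℕ → ℕ) → ℕ
sumTo N f = sum (applyUpTo f N)

sumTo-cong : ∀ N {f g : ℕ → ℕ} → (∀ t → t < N → f t ≡ g t) → sumTo N f ≡ sumTo N g
sumTo-cong zero _ = refl
sumTo-cong (suc N) f≡g = cong₂ _+_ (f≡g 0 (s≤s z≤n)) (sumTo-cong N (λ t t<N → f≡g (suc t) (s≤s t<N)))

sumTo-+ : ∀ N (f g : ℕ → ℕ) → sumTo N (λ t → f t + g t) ≡ sumTo N f + sumTo N g
sumTo-+ zero f g = refl
sumTo-+ (suc N) f g = trans (cong (f 0 + g 0 +_) (sumTo-+ N (f ∘ suc) (g ∘ suc)))
  (interchange (f 0) (g 0) (sumTo N (f ∘ suc)) (sumTo N (g ∘ suc)))
  where
  interchange : ∀ a b c d → a + b + (c + d) ≡ a + c + (b + d)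
  interchange = solve-∀

sumTo-suc : ∀ N (f : ℕ → ℕ) → sumTo (suc N) f ≡ sumTo N f + f N
sumTo-suc zero f = +-comm (f 0) 0
sumTo-suc (suc N) f = trans (cong (f 0 +_) (sumTo-suc N (f ∘ suc))) (sym (+-assoc (f 0) _ _))

sumTo-zero : ∀ N (f : ℕ → ℕ) → (∀ t → t < N → f t ≡ 0) → sumTo N f ≡ 0
sumTo-zero zero f _ = refl
sumTo-zero (suc N) f f≡0 rewrite f≡0 0 (s≤s z≤n) = sumTo-zero N (f ∘ suc) (λ t t<N → f≡0 (suc t) (s≤s t<N))

mutual
  codeCount : ℕ → ℕ → ℕ
  codeCount zero zero = 1
  codeCount zero (suc k) = 0
  codeCount (suc j) k = codeCount j k + presentCodeCount (suc j) k

  presentCodeCount : ℕ → ℕ → ℕ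
  presentCodeCount zero k = 0
  presentCodeCount (suc j) zero = 0
  presentCodeCount (suc j) (suc k) = codeCount j k + presentCodeCount j k

codeCount-0 : ∀ j → codeCount j 0 ≡ 1
codeCount-0 zero = refl
codeCount-0 (suc zero) = refl
codeCount-0 (suc (suc j)) = trans (+-identityʳ (codeCount (suc j) 0)) (codeCount-0 (suc j))

mutual
  codeCount-heavy : ∀ j k → j < k → codeCount j k ≡ 0
  codeCount-heavy zero (suc k) _ = refl
  codeCount-heavy (suc j) k j<k =
    cong₂ _+_ (codeCount-heavy j k (<-trans (n<1+n j) j<k)) (presentCodeCount-heavy (suc j) k j<k)

  presentCodeCount-heavy : ∀ j k → j < k → presentCodeCount j k ≡ 0
  presentCodeCount-heavy zero k _ = refl
  presentCodeCount-heavy (suc j) (suc k) (s≤s j<k) = cong₂ _+_ (codeCount-heavy j k j<k) (presentCodeCount-heavy j k j<k)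

-- formula (suc m) (suc k) unfolds to G m k, the number of codes of length m and
-- weight k + 1; E m k is the number of those of length m + 1 and weight k + 1
-- that start with a present letter.
G E : ℕ → ℕ → ℕ
G m k = sumTo (suc k) (λ t → ((m ∸ t) C (suc k ∸ t)) * (k C t))
E m k = sumTo (suc k) (λ t → ((m ∸ t) C (k ∸ t)) * (k C t))

G-heavy : ∀ m k → m ≤ k → G m k ≡ 0
G-heavy m k m≤k = sumTo-zero (suc k) _ λ t t≤k → cong (_* (k C t)) (k>n⇒nCk≡0
  (≤-<-trans (∸-monoˡ-≤ t m≤k) (subst (k ∸ t <_) (sym (+-∸-assoc 1 (≤-pred t≤k))) ≤-refl)))

G-suc : ∀ m k → k ≤ m → G (suc m) k ≡ G m k + E m k
G-suc m k k≤m = trans (sumTo-cong (suc k) (λ t t≤k → pascal t (≤-pred t≤k)))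
  (trans (sumTo-+ (suc k) (λ t → ((m ∸ t) C (k ∸ t)) * (k C t)) (λ t → ((m ∸ t) C (suc k ∸ t)) * (k C t)))
         (+-comm (E m k) (G m k)))
  where
  pascal : ∀ t → t ≤ k → ((suc m ∸ t) C (suc k ∸ t)) * (k C t) ≡
                         ((m ∸ t) C (k ∸ t)) * (k C t) + ((m ∸ t) C (suc k ∸ t)) * (k C t)
  pascal t t≤k = begin
    ((suc m ∸ t) C (suc k ∸ t)) * (k C t)
      ≡⟨ cong₂ (λ a b → (a C b) * (k C t)) (+-∸-assoc 1 (≤-trans t≤k k≤m)) (+-∸-assoc 1 t≤k) ⟩
    (suc (m ∸ t) C suc (k ∸ t)) * (k C t)
      ≡⟨ cong (_* (k C t)) (nCk+nC[k+1]≡[n+1]C[k+1] (m ∸ t) (k ∸ t)) ⟨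
    ((m ∸ t) C (k ∸ t) + (m ∸ t) C suc (k ∸ t)) * (k C t)
      ≡⟨ *-distribʳ-+ (k C t) ((m ∸ t) C (k ∸ t)) _ ⟩
    ((m ∸ t) C (k ∸ t)) * (k C t) + ((m ∸ t) C suc (k ∸ t)) * (k C t)
      ≡⟨ cong (λ b → ((m ∸ t) C (k ∸ t)) * (k C t) + ((m ∸ t) C b) * (k C t)) (+-∸-assoc 1 t≤k) ⟨
    ((m ∸ t) C (k ∸ t)) * (k C t) + ((m ∸ t) C (suc k ∸ t)) * (k C t) ∎
    where open ≡-Reasoning

E-suc : ∀ m k → E (suc m) (suc k) ≡ G (suc m) k + E m k
E-suc m k = begin
  (suc m C suc k) * 1 + sumTo (suc k) (λ t → ((m ∸ t) C (k ∸ t)) * (suc k C suc t))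
    ≡⟨ cong ((suc m C suc k) * 1 +_) (trans (sumTo-cong (suc k) (λ t _ → pascal t)) (sumTo-+ (suc k) a b)) ⟩
  (suc m C suc k) * 1 + (sumTo (suc k) a + sumTo (suc k) b)
    ≡⟨ cong (λ x → (suc m C suc k) * 1 + (sumTo (suc k) a + x)) (trans (sumTo-suc k b) (cong (sumTo k b +_) b-last)) ⟩
  (suc m C suc k) * 1 + (sumTo (suc k) a + (sumTo k b + 0))
    ≡⟨ regroup ((suc m C suc k) * 1) (sumTo (suc k) a) (sumTo k b) ⟩
  (suc m C suc k) * 1 + sumTo k b + sumTo (suc k) a ∎
  where
  open ≡-Reasoning
  a b : ℕ → ℕ
  a t = ((m ∸ t) C (k ∸ t)) * (k C t)
  b t = ((m ∸ t) C (k ∸ t)) * (k C suc t)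
  pascal : ∀ t → ((m ∸ t) C (k ∸ t)) * (suc k C suc t) ≡ a t + b t
  pascal t = trans (cong (((m ∸ t) C (k ∸ t)) *_) (sym (nCk+nC[k+1]≡[n+1]C[k+1] k t)))
                   (*-distribˡ-+ ((m ∸ t) C (k ∸ t)) (k C t) (k C suc t))
  b-last : b k ≡ 0
  b-last = trans (cong (((m ∸ k) C (k ∸ k)) *_) (k>n⇒nCk≡0 (n<1+n k))) (*-zeroʳ ((m ∸ k) C (k ∸ k)))
  regroup : ∀ x y z → x + (y + (z + 0)) ≡ x + z + y
  regroup = solve-∀

mutual
  codeCount≡G : ∀ m k → codeCount m (suc k) ≡ G m k
  codeCount≡G zero k = sym (G-heavy 0 k z≤n)
  codeCount≡G (suc m) k with k ℕ.≤? m
  ... | yes k≤m = trans (cong₂ _+_ (codeCount≡G m k) (presentCodeCount≡E m k k≤m)) (sym (G-suc m k k≤m))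
  ... | no k≰m = begin
    codeCount m (suc k) + presentCodeCount (suc m) (suc k)
      ≡⟨ cong₂ _+_ (codeCount≡G m k) (presentCodeCount-heavy (suc m) (suc k) (s≤s (≰⇒> k≰m))) ⟩
    G m k + 0
      ≡⟨ trans (+-identityʳ _) (G-heavy m k (<⇒≤ (≰⇒> k≰m))) ⟩
    0
      ≡⟨ G-heavy (suc m) k (≰⇒> k≰m) ⟨
    G (suc m) k ∎
    where open ≡-Reasoning

  presentCodeCount≡E : ∀ m k → k ≤ m → presentCodeCount (suc m) (suc k) ≡ E m k
  presentCodeCount≡E zero zero _ = refl
  presentCodeCount≡E (suc m) zero _ = cong (_+ 0) (codeCount-0 (suc m))
  presentCodeCount≡E (suc m) (suc k) (s≤s k≤m) =
    trans (cong₂ _+_ (codeCount≡G (suc m) k) (presentCodeCount≡E m k k≤m)) (sym (E-suc m k))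

codeCount≡formula : ∀ m k → codeCount m k ≡ formula (suc m) k
codeCount≡formula m zero = codeCount-0 m
codeCount≡formula m (suc k) = codeCount≡G m k

mutual
  codes : ℕ → ℕ → List (List Letter)
  codes zero zero = [] ∷ []
  codes zero (suc k) = []
  codes (suc j) k = L.map (skip ∷_) (codes j k) ++ presentCodes (suc j) k

  presentCodes : ℕ → ℕ → List (List Letter)
  presentCodes zero k = []
  presentCodes (suc j) zero = []
  presentCodes (suc j) (suc k) = L.map (onLeft ∷_) (codes j k) ++ L.map (onRight ∷_) (presentCodes j k)

mutual
  length-codes : ∀ j k → length (codes j k) ≡ codeCount j k
  length-codes zero zero = refl
  length-codes zero (suc k) = refl
  length-codes (suc j) k = trans (length-++ (L.map (skip ∷_) (codes j k)))
    (cong₂ _+_ (trans (length-map _ (codes j k)) (length-codes j k)) (length-presentCodes (suc j) k))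

  length-presentCodes : ∀ j k → length (presentCodes j k) ≡ presentCodeCount j k
  length-presentCodes zero k = refl
  length-presentCodes (suc j) zero = refl
  length-presentCodes (suc j) (suc k) = trans (length-++ (L.map (onLeft ∷_) (codes j k)))
    (cong₂ _+_ (trans (length-map _ (codes j k)) (length-codes j k))
               (trans (length-map _ (presentCodes j k)) (length-presentCodes j k)))

Good : ℕ → ℕ → List Letter → Set
Good j k cs = Valid cs × length cs ≡ j × weight cs ≡ k

mutual
  ∈codes⇒good : ∀ j k {cs} → cs ∈ codes j k → Good j k cs
  ∈codes⇒good zero zero (here refl) = tt , refl , refl
  ∈codes⇒good (suc j) k cs∈ with ∈-++⁻ (L.map (skip ∷_) (codes j k)) cs∈
  ... | inj₁ cs∈skip with ∈-map⁻ (skip ∷_) cs∈skip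
  ...   | cs′ , cs′∈ , refl = let (valid , len≡ , weight≡) = ∈codes⇒good j k cs′∈ in
      valid , cong suc len≡ , weight≡
  ∈codes⇒good (suc j) k cs∈ | inj₂ cs∈present = let (valid , _ , len≡ , weight≡) = ∈presentCodes⇒good (suc j) k cs∈present in
    valid , len≡ , weight≡

  ∈presentCodes⇒good : ∀ j k {cs} → cs ∈ presentCodes j k → Valid cs × StartsPresent cs ×
    length cs ≡ j × weight cs ≡ k
  ∈presentCodes⇒good (suc j) (suc k) cs∈ with ∈-++⁻ (L.map (onLeft ∷_) (codes j k)) cs∈
  ... | inj₁ cs∈left with ∈-map⁻ (onLeft ∷_) cs∈left
  ...   | cs′ , cs′∈ , refl = let (valid , len≡ , weight≡) = ∈codes⇒good j k cs′∈ in
    valid , tt , cong suc len≡ , cong suc weight≡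
  ∈presentCodes⇒good (suc j) (suc k) cs∈ | inj₂ cs∈right with ∈-map⁻ (onRight ∷_) cs∈right
  ... | cs′ , cs′∈ , refl = let (valid , present , len≡ , weight≡) = ∈presentCodes⇒good j k cs′∈ in
    (valid , present) , tt , cong suc len≡ , cong suc weight≡

mutual
  valid⇒∈codes : ∀ cs → Valid cs → cs ∈ codes (length cs) (weight cs)
  valid⇒∈codes [] _ = here refl
  valid⇒∈codes (skip ∷ cs) valid = ∈-++⁺ˡ (∈-map⁺ (skip ∷_) (valid⇒∈codes cs valid))
  valid⇒∈codes (onLeft ∷ cs) valid =
    ∈-++⁺ʳ (L.map (skip ∷_) (codes (length cs) _)) (valid⇒∈presentCodes (onLeft ∷ cs) valid tt)
  valid⇒∈codes (onRight ∷ cs) valid =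
    ∈-++⁺ʳ (L.map (skip ∷_) (codes (length cs) _)) (valid⇒∈presentCodes (onRight ∷ cs) valid tt)

  valid⇒∈presentCodes : ∀ cs → Valid cs → StartsPresent cs → cs ∈ presentCodes (length cs) (weight cs)
  valid⇒∈presentCodes (onLeft ∷ cs) valid _ = ∈-++⁺ˡ (∈-map⁺ (onLeft ∷_) (valid⇒∈codes cs valid))
  valid⇒∈presentCodes (onRight ∷ cs) (valid , present) _ =
    ∈-++⁺ʳ (L.map (onLeft ∷_) (codes (length cs) _)) (∈-map⁺ (onRight ∷_) (valid⇒∈presentCodes cs valid present))

mutual
  codes-unique : ∀ j k → Unique (codes j k)
  codes-unique zero zero = [] ∷ []
  codes-unique zero (suc k) = []
  codes-unique (suc j) k = Unique.++⁺ (Unique.map⁺ ∷-injectiveʳ (codes-unique j k)) (presentCodes-unique (suc j) k) disjoint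
    where
    disjoint : ∀ {cs} → ¬ (cs ∈ L.map (skip ∷_) (codes j k) × cs ∈ presentCodes (suc j) k)
    disjoint (cs∈skip , cs∈present) with ∈-map⁻ (skip ∷_) cs∈skip
    ... | _ , _ , refl = proj₁ (proj₂ (∈presentCodes⇒good (suc j) k cs∈present))

  presentCodes-unique : ∀ j k → Unique (presentCodes j k)
  presentCodes-unique zero k = []
  presentCodes-unique (suc j) zero = []
  presentCodes-unique (suc j) (suc k) =
    Unique.++⁺ (Unique.map⁺ ∷-injectiveʳ (codes-unique j k)) (Unique.map⁺ ∷-injectiveʳ (presentCodes-unique j k)) disjoint
    where
    disjoint : ∀ {cs} → ¬ (cs ∈ L.map (onLeft ∷_) (codes j k) × cs ∈ L.map (onRight ∷_) (presentCodes j k))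
    disjoint (cs∈left , cs∈right) with ∈-map⁻ (onLeft ∷_) cs∈left | ∈-map⁻ (onRight ∷_) cs∈right
    ... | _ , _ , refl | _ , _ , ()

Unique-map : ∀ {A B : Set} (f : A → B) (xs : List A) → Unique xs →
  (∀ {x y} → x ∈ xs → y ∈ xs → f x ≡ f y → x ≡ y) → Unique (L.map f xs)
Unique-map f [] _ _ = []
Unique-map f (x ∷ xs) (x∉xs ∷ unique) f-inj =
  All-map xs x∉xs (λ y∈ → f-inj (here refl) (there y∈))
    ∷ Unique-map f xs unique (λ x∈ y∈ → f-inj (there x∈) (there y∈))
  where
  All-map : ∀ ys → All (x ≢_) ys → (∀ {y} → y ∈ ys → f x ≡ f y → x ≡ y) → All (f x ≢_) (L.map f ys)
  All-map [] [] _ = []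
  All-map (y ∷ ys) (x≢y ∷ x∉ys) inj = (x≢y ∘ inj (here refl)) ∷ All-map ys x∉ys (inj ∘ there)

module Codes (m : ℕ) where

  sˡ sʳ : ℕ → Word (suc m) → Word (suc m)
  sˡ j = tmul (clamp m j) (clamp m (suc j))
  sʳ j = swapPos (clamp m j) (clamp m (suc j))

  sˡ-involutive : ∀ j w → sˡ j (sˡ j w) ≡ w
  sˡ-involutive j = tmul-involutive (clamp m j) (clamp m (suc j))

  sʳ-involutive : ∀ j w → sʳ j (sʳ j w) ≡ w
  sʳ-involutive j = swapPos-involutive (clamp m j) (clamp m (suc j))

  word : List Letter → Word (suc m)
  word [] = identity
  word (skip ∷ cs) = word cs
  word (onLeft ∷ cs) = sˡ (length cs) (word cs)
  word (onRight ∷ cs) = sʳ (length cs) (word cs)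

  record BooleanPerm (j r : ℕ) (w : Word (suc m)) : Set where
    field
      perm′ : Perm w
      fixes : FixesAbove j w
      ℓ≡ : ℓ w ≡ r
      boolean : BooleanIdeal w r

  extend : ∀ {j r w} (M : SideMultiplication {suc m} j) → suc j ≤ m →
    BooleanPerm j r w → BooleanPerm (suc j) (suc r) (SideMultiplication.σ M w)
  extend {j} M sj≤m B = record
    { perm′ = σ-perm perm′
    ; fixes = σ-fixesAbove perm′ fixes
    ; ℓ≡ = trans (⋖.ℓ≡suc (σ-⋖ perm′ fixes)) (cong suc ℓ≡)
    ; boolean = Extend.booleanIdeal-σ M (clamp m (suc j)) (toℕ-clamp m (suc j) sj≤m) perm′ fixes boolean }
    where
    open SideMultiplication M
    open BooleanPerm B

  word-boolean : ∀ cs → length cs ≤ m → BooleanPerm (length cs) (weight cs) (word cs)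
  word-boolean [] _ = record
    { perm′ = identity-perm ; fixes = identity-fixesAbove 0 ; ℓ≡ = ℓ-identity ; boolean = booleanIdeal-identity }
  word-boolean (skip ∷ cs) k≤m = record
    { perm′ = perm′ ; fixes = fixesAbove-suc fixes ; ℓ≡ = ℓ≡ ; boolean = boolean }
    where open BooleanPerm (word-boolean cs (≤-trans (n≤1+n _) k≤m))
  word-boolean (onLeft ∷ cs) k≤m =
    extend (Left.leftMultiplication m (length cs) k≤m) k≤m (word-boolean cs (≤-trans (n≤1+n _) k≤m))
  word-boolean (onRight ∷ cs) k≤m =
    extend (Right.rightMultiplication m (length cs) k≤m) k≤m (word-boolean cs (≤-trans (n≤1+n _) k≤m))

  value : Word (suc m) → ℕ → ℕ
  value w i = toℕ (lookup w (clamp m i))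

  Descent : Word (suc m) → ℕ → Set
  Descent w i = value w (suc i) < value w i

  descent? : ∀ w k → (∃ λ i → i < k × Descent w i) ⊎ (∀ i → i < k → ¬ Descent w i)
  descent? w zero = inj₂ λ _ ()
  descent? w (suc k) with descent? w k
  ... | inj₁ (i , i<k , desc) = inj₁ (i , ≤-trans i<k (n≤1+n k) , desc)
  ... | inj₂ none with value w (suc k) <? value w k
  ...   | yes desc = inj₁ (k , ≤-refl , desc)
  ...   | no no-desc = inj₂ λ i i<sk → case i (≤-pred i<sk)
    where
    case : ∀ i → i ≤ k → ¬ Descent w i
    case i i≤k with i ℕ.≟ k
    ... | yes refl = no-desc
    ... | no i≢k = none i (≤∧≢⇒< i≤k i≢k)

  -- Without descents the values increase, so value w i ≥ i counting up from 0
  -- and value w i ≤ i counting down from m.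
  noDescent⇒identity : ∀ {w} → Perm w → (∀ i → i < m → ¬ Descent w i) → w ≡ identity
  noDescent⇒identity {w} w-perm none = vec-ext λ q →
    trans (cong (lookup w) (sym (clamp-toℕ m q)))
      (trans (toℕ-injective (value≡ (toℕ q) (≤-pred (FP.toℕ<n q)))) (sym (lookup-identity q)))
    where
    increasing : ∀ i → i < m → value w i < value w (suc i)
    increasing i i<m with <-cmp (value w i) (value w (suc i))
    ... | tri< lt _ _ = lt
    ... | tri≈ _ eq _ = contradiction (trans (sym (toℕ-clamp m (suc i) i<m))
           (trans (cong toℕ (sym (lookup-injective w-perm _ _ (toℕ-injective eq)))) (toℕ-clamp m i (<⇒≤ i<m)))) 1+n≢n
    ... | tri> _ _ gt = contradiction gt (none i i<m)
    at-least : ∀ i → i ≤ m → i ≤ value w i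
    at-least zero _ = z≤n
    at-least (suc i) si≤m = ≤-trans (s≤s (at-least i (<⇒≤ si≤m))) (increasing i si≤m)
    at-most : ∀ k → k ≤ m → value w (m ∸ k) ≤ m ∸ k
    at-most zero _ = ≤-pred (FP.toℕ<n (lookup w (clamp m m)))
    at-most (suc k) sk≤m = ≤-pred (<-≤-trans (increasing (m ∸ suc k) i<m)
                                            (subst (λ t → value w t ≤ t) (sym suc-i≡) (at-most k (<⇒≤ sk≤m))))
      where
      suc-i≡ : suc (m ∸ suc k) ≡ m ∸ k
      suc-i≡ = sym (+-∸-assoc 1 sk≤m)
      i<m : m ∸ suc k < m
      i<m = ≤-trans (≤-reflexive suc-i≡) (m∸n≤m m k)
    value≡ : ∀ i → i ≤ m → value w i ≡ i
    value≡ i i≤m = ≤-antisym (subst (λ t → value w t ≤ t) (m∸[m∸n]≡n i≤m) (at-most (m ∸ i) (m∸n≤m m i)))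
      (at-least i i≤m)

  descent-⋖ : ∀ {w} → Perm w → ∀ i → i < m → Descent w i → sʳ i w ⋖ w
  descent-⋖ {w} w-perm i i<m desc = record
    { a = lookup w c ; b = lookup w d ; a≢b = c≢d ∘ lookup-injective w-perm c d
    ; x≡tmul = sym (trans (cong (tmul (lookup w c) (lookup w d)) sʳw≡) (tmul-involutive _ _ w))
    ; ℓ≡suc = trans (ℓ-transpose-adjacentPositions w-perm c d d≡suc-c desc) (cong (suc ∘ ℓ) (sym sʳw≡)) }
    where
    open Adjacent m i i<m
    d≡suc-c : toℕ d ≡ suc (toℕ c)
    d≡suc-c = trans toℕ-d (cong suc (sym toℕ-c))
    sʳw≡ : sʳ i w ≡ tmul (lookup w c) (lookup w d) w
    sʳw≡ = swapPos≡tmul c d w-perm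

  descent-induction : (P : Word (suc m) → Set) → P identity →
    (∀ {w} i → i < m → Perm w → sʳ i w ⋖ w → P (sʳ i w) → P w) → ∀ {w} → Perm w → P w
  descent-induction P base step {w} w-perm = go (ℓ w) ≤-refl w-perm
    where
    go : ∀ k {w} → ℓ w ≤ k → Perm w → P w
    go k {w} ℓw≤k w-perm with descent? w m
    ... | inj₂ none = subst P (sym (noDescent⇒identity w-perm none)) base
    ... | inj₁ (i , i<m , desc) = shrink k (≤-trans (≤-reflexive (sym (⋖.ℓ≡suc cov))) ℓw≤k)
      where
      cov = descent-⋖ w-perm i i<m desc
      shrink : ∀ k → suc (ℓ (sʳ i w)) ≤ k → P w
      shrink (suc k) (s≤s ℓ≤k) = step i i<m w-perm cov (go k ℓ≤k (swapPos-perm (clamp m i) (clamp m (suc i)) w-perm))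

  identity-≼ : ∀ {v} → Perm v → identity ≼ v
  identity-≼ = descent-induction (identity ≼_) ε (λ _ _ _ cov id≼ → id≼ ◅ʳ cov)

  ℓ≡0⇒identity : ∀ {v} → Perm v → ℓ v ≡ 0 → v ≡ identity
  ℓ≡0⇒identity {v} v-perm ℓv≡0 with descent? v m
  ... | inj₂ none = noDescent⇒identity v-perm none
  ... | inj₁ (i , i<m , desc) = contradiction (trans (sym (⋖.ℓ≡suc (descent-⋖ v-perm i i<m desc))) ℓv≡0) 1+n≢0

  closed≤? : ∀ i (w : Word (suc m)) → Dec (Closed≤ i w)
  closed≤? i w = FP.all? (λ q → (toℕ q ℕ.≤? i) →-dec (toℕ (lookup w q) ℕ.≤? i))

  -- s_i occurs in (every reduced word of) w exactly when w does not preserve {0, …, i}.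
  uses : Word (suc m) → ℕ → Bool
  uses w i = not ⌊ closed≤? i w ⌋

  support : Word (suc m) → ℕ
  support w = count (uses w) m

  uses-intro : ∀ {w i} → ¬ Closed≤ i w → uses w i ≡ true
  uses-intro {w} {i} not-closed with closed≤? i w
  ... | yes closed = contradiction closed not-closed
  ... | no _ = refl

  uses-elim : ∀ {w i} → uses w i ≡ true → ¬ Closed≤ i w
  uses-elim {w} {i} uses≡true closed with closed≤? i w
  ... | no not-closed = not-closed closed

  uses-mono : ∀ {w w′ i} → (Closed≤ i w′ → Closed≤ i w) → uses w i ≡ true → uses w′ i ≡ true
  uses-mono {w} {w′} closed⇒closed uses≡true = uses-intro {w′} (uses-elim {w} uses≡true ∘ closed⇒closed)

  support-identity : support identity ≡ 0
  support-identity = count-zero m λ i _ → unused i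
    where
    unused : ∀ i → uses identity i ≡ false
    unused i with closed≤? i identity
    ... | yes _ = refl
    ... | no not-closed = contradiction (λ q q≤i → subst (λ t → toℕ t ≤ i) (sym (lookup-identity q)) q≤i) not-closed

  module _ (i₀ : ℕ) (i₀<m : i₀ < m) where
    open Adjacent m i₀ i₀<m

    private
      above-i₀ : ∀ {i} → i₀ ≤ i → i ≢ i₀ → toℕ d ≤ i
      above-i₀ i₀≤i i≢i₀ = subst (_≤ _) (sym toℕ-d) (≤∧≢⇒< i₀≤i (i≢i₀ ∘ sym))

      c≤d : toℕ c ≤ toℕ d
      c≤d = subst₂ _≤_ (sym toℕ-c) (sym toℕ-d) (n≤1+n i₀)

    closed≤-sˡ : ∀ {i y} → i ≢ i₀ → Closed≤ i y → Closed≤ i (sˡ i₀ y)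
    closed≤-sˡ {i} {y} i≢i₀ y-closed q q≤i with transpCase c d (lookup y q)
    ... | is-left yq≡c = subst (λ t → toℕ t ≤ i) (sym (lookup-tmul-left c d y q yq≡c))
      (above-i₀ (subst (_≤ i) (trans (cong toℕ yq≡c) toℕ-c) (y-closed q q≤i)) i≢i₀)
    ... | is-right yq≡d _ = subst (λ t → toℕ t ≤ i) (sym (lookup-tmul-right c d y q yq≡d))
      (≤-trans c≤d (subst (λ t → toℕ t ≤ i) yq≡d (y-closed q q≤i)))
    ... | is-other yq≢c yq≢d = subst (λ t → toℕ t ≤ i) (sym (lookup-tmul-other c d y q yq≢c yq≢d)) (y-closed q q≤i)

    closed≤-sʳ : ∀ {i y} → i ≢ i₀ → Closed≤ i y → Closed≤ i (sʳ i₀ y)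
    closed≤-sʳ {i} {y} i≢i₀ y-closed q q≤i with transpCase c d q
    ... | is-left refl = subst (λ t → toℕ t ≤ i) (sym (trans (lookup-swapPos c d y c) (cong (lookup y) (transp-left c d))))
      (y-closed d (above-i₀ (subst (_≤ i) toℕ-c q≤i) i≢i₀))
    ... | is-right refl _ = subst (λ t → toℕ t ≤ i) (sym (trans (lookup-swapPos c d y d) (cong (lookup y) (transp-right c d))))
      (y-closed c (≤-trans c≤d q≤i))
    ... | is-other q≢c q≢d = subst (λ t → toℕ t ≤ i)
        (sym (trans (lookup-swapPos c d y q) (cong (lookup y) (transp-other c d q q≢c q≢d))))
      (y-closed q q≤i)

  -- Removing the descent s_i removes at most one generator from the support.
  support≤ℓ : ∀ {w} → Perm w → support w ≤ ℓ w
  support≤ℓ = descent-induction (λ w → support w ≤ ℓ w) (≤-reflexive (trans support-identity (sym ℓ-identity))) step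
    where
    step : ∀ {w} i → i < m → Perm w → sʳ i w ⋖ w → support (sʳ i w) ≤ ℓ (sʳ i w) → support w ≤ ℓ w
    step {w} i i<m _ cov support≤ = begin
      support w                    ≤⟨ count-mono-except m i (λ i′ _ i′≢i → uses-mono {w} {sʳ i w} (closed-back i′≢i)) ⟩
      suc (support (sʳ i w))       ≤⟨ s≤s support≤ ⟩
      suc (ℓ (sʳ i w))             ≡⟨ ⋖.ℓ≡suc cov ⟨
      ℓ w                          ∎
      where
      open ≤-Reasoning
      closed-back : ∀ {i′} → i′ ≢ i → Closed≤ i′ (sʳ i w) → Closed≤ i′ w
      closed-back i′≢i closed = subst (Closed≤ _) (sʳ-involutive i w) (closed≤-sʳ i i<m {y = sʳ i w} i′≢i closed)

  -- In a boolean ideal of rank r the length is at most r, and the r atoms are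
  -- distinct simple reflections s_i lying below w, each of which forces s_i into
  -- the support of w.
  module _ {w : Word (suc m)} {r : ℕ} (w-perm : Perm w) (B : BooleanIdeal w r) where
    open BooleanIdeal B

    ℓ≤∣f∣ : ∀ {v} → Perm v → v ≼ w → ℓ v ≤ ∣ f v ∣
    ℓ≤∣f∣ = descent-induction (λ v → v ≼ w → ℓ v ≤ ∣ f v ∣) (λ _ → subst (_≤ ∣ f identity ∣) (sym ℓ-identity) z≤n)
      step
      where
      step : ∀ {v} i → i < m → Perm v → sʳ i v ⋖ v → (sʳ i v ≼ w → ℓ (sʳ i v) ≤ ∣ f (sʳ i v) ∣) →
        v ≼ w → ℓ v ≤ ∣ f v ∣
      step {v} i _ v-perm cov ih v≼w = begin
        ℓ v                      ≡⟨ ⋖.ℓ≡suc cov ⟩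
        suc (ℓ v′)               ≤⟨ s≤s (ih (cov ◅ v≼w)) ⟩
        suc ∣ f v′ ∣             ≤⟨ p⊆q∧p≢q⇒∣p∣<∣q∣ (f v′) (f v) (f-mono v′-perm (cov ◅ v≼w) v-perm v≼w (cov ◅ ε)) fv′≢fv ⟩
        ∣ f v ∣                  ∎
        where
        open ≤-Reasoning
        v′ = sʳ i v
        v′-perm : Perm v′
        v′-perm = swapPos-perm (clamp m i) (clamp m (suc i)) v-perm
        fv′≢fv : f v′ ≢ f v
        fv′≢fv eq = 1+n≢n (trans (sym (⋖.ℓ≡suc cov))
          (cong ℓ (sym (trans (sym (g∘f v′-perm (cov ◅ v≼w))) (trans (cong g eq) (g∘f v-perm v≼w))))))

    ℓ≤rank : ℓ w ≤ r
    ℓ≤rank = ≤-trans (ℓ≤∣f∣ w-perm ε) (∣p∣≤n (f w))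

    atom≢identity : ∀ a → g ⁅ a ⁆ ≢ identity
    atom≢identity a eq = ∉∅ (subst (a ∈ₛ_) (f∘g ∅) (f-identity⊆ (subst (a ∈ₛ_) fa≡ (x∈⁅x⁆ a))))
      where
      fa≡ : ⁅ a ⁆ ≡ f identity
      fa≡ = trans (sym (f∘g ⁅ a ⁆)) (cong f eq)
      f-identity⊆ : f identity ⊆ f (g ∅)
      f-identity⊆ = f-mono identity-perm (identity-≼ w-perm) (g-perm ∅) (g-≼ ∅) (identity-≼ (g-perm ∅))

    atom : ∀ a → ∃ λ i → i < m × g ⁅ a ⁆ ≡ sʳ i identity
    atom a with descent? (g ⁅ a ⁆) m
    ... | inj₂ none = ⊥-elim (atom≢identity a (noDescent⇒identity (g-perm ⁅ a ⁆) none))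
    ... | inj₁ (i , i<m , desc) = i , i<m ,
      trans (sym (sʳ-involutive i (g ⁅ a ⁆))) (cong (sʳ i) v′≡identity)
      where
      cov = descent-⋖ (g-perm ⁅ a ⁆) i i<m desc
      ℓ≤1 : ℓ (g ⁅ a ⁆) ≤ 1
      ℓ≤1 = ≤-trans (ℓ≤∣f∣ (g-perm ⁅ a ⁆) (g-≼ ⁅ a ⁆))
        (≤-reflexive (trans (cong ∣_∣ (f∘g ⁅ a ⁆)) (∣⁅x⁆∣≡1 a)))
      v′≡identity : sʳ i (g ⁅ a ⁆) ≡ identity
      v′≡identity = ℓ≡0⇒identity (swapPos-perm (clamp m i) (clamp m (suc i)) (g-perm ⁅ a ⁆))
        (n≤0⇒n≡0 (≤-pred (≤-trans (≤-reflexive (sym (⋖.ℓ≡suc cov))) ℓ≤1)))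

    atom-index : Fin r → ℕ
    atom-index a = proj₁ (atom a)

    atom-index-injective : ∀ a b → atom-index a ≡ atom-index b → a ≡ b
    atom-index-injective a b eq = x∈⁅y⁆⇒x≡y b (subst (a ∈ₛ_) ⁅a⁆≡⁅b⁆ (x∈⁅x⁆ a))
      where
      ga≡gb : g ⁅ a ⁆ ≡ g ⁅ b ⁆
      ga≡gb = trans (proj₂ (proj₂ (atom a))) (trans (cong (λ i → sʳ i identity) eq) (sym (proj₂ (proj₂ (atom b)))))
      ⁅a⁆≡⁅b⁆ : ⁅ a ⁆ ≡ ⁅ b ⁆
      ⁅a⁆≡⁅b⁆ = trans (sym (f∘g ⁅ a ⁆)) (trans (cong f ga≡gb) (f∘g ⁅ b ⁆))

    atom-index-used : ∀ a → uses w (atom-index a) ≡ true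
    atom-index-used a = uses-intro {w} λ w-closed →
      s-not-closed (closed≤-≼ (swapPos-perm c d identity-perm) (subst (_≼ w) ga≡ (g-≼ ⁅ a ⁆)) w-closed)
      where
      i = atom-index a
      i<m = proj₁ (proj₂ (atom a))
      ga≡ = proj₂ (proj₂ (atom a))
      open Adjacent m i i<m
      s-not-closed : ¬ Closed≤ i (sʳ i identity)
      s-not-closed closed = <-irrefl refl (≤-trans
        (subst (λ t → suc i ≤ toℕ t)
          (sym (trans (lookup-swapPos c d identity c) (trans (cong (lookup identity) (transp-left c d)) (lookup-identity d))))
          (≤-reflexive (sym toℕ-d)))
        (closed c (≤-reflexive toℕ-c)))

    ℓ≤support : ℓ w ≤ support w
    ℓ≤support = ≤-trans ℓ≤rank
      (injection⇒≤count m r atom-index atom-index-injective (λ a → proj₁ (proj₂ (atom a))) atom-index-used)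

  record Coded (j : ℕ) (w : Word (suc m)) : Set where
    field
      code : List Letter
      valid : Valid code
      length≡ : length code ≡ j
      word≡ : word code ≡ w
      weight≡ : weight code ≡ ℓ w

  word-fixes-next : ∀ cs → length cs ≤ m → ¬ StartsPresent cs →
    lookup (word cs) (clamp m (length cs)) ≡ clamp m (length cs)
  word-fixes-next [] _ _ = lookup-identity _
  word-fixes-next (skip ∷ cs) sk≤m _ = fixesAt (BooleanPerm.fixes (word-boolean cs (≤-trans (n≤1+n _) sk≤m))) _
    (subst (length cs <_) (sym (toℕ-clamp m (suc (length cs)) sk≤m)) ≤-refl)
  word-fixes-next (onLeft ∷ cs) _ absent = ⊥-elim (absent tt)
  word-fixes-next (onRight ∷ cs) _ absent = ⊥-elim (absent tt)

  fixesAbove-0⇒identity : ∀ {w : Word (suc m)} → Perm w → FixesAbove 0 w → w ≡ identity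
  fixesAbove-0⇒identity {w} w-perm w-fix = vec-ext λ q → trans (fixed q) (sym (lookup-identity q))
    where
    fixed : ∀ q → lookup w q ≡ q
    fixed fzero = toℕ-injective (n≤0⇒n≡0 (value-below w-perm w-fix fzero z≤n))
    fixed (fsuc q) = fixesAt w-fix (fsuc q) (s≤s z≤n)

  ℓ≤support-⋖ : ∀ {w w′} i → w′ ⋖ w → (∀ {i′} → i′ ≢ i → Closed≤ i′ w′ → Closed≤ i′ w) →
    ℓ w ≤ support w → ℓ w′ ≤ support w′
  ℓ≤support-⋖ {w} {w′} i cov closed-back ℓ≤supp = ≤-pred (begin
    suc (ℓ w′)          ≡⟨ ⋖.ℓ≡suc cov ⟨
    ℓ w                 ≤⟨ ℓ≤supp ⟩
    support w           ≤⟨ count-mono-except m i (λ i′ _ i′≢i → uses-mono {w} {w′} (closed-back i′≢i)) ⟩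
    suc (support w′)    ∎)
    where open ≤-Reasoning

  same-support-⋖ : ∀ {w w′} → Perm w′ → w′ ⋖ w → (∀ {i} → Closed≤ i w′ → Closed≤ i w) →
    ¬ ℓ w ≤ support w
  same-support-⋖ {w} {w′} w′-perm cov closed-back ℓ≤supp = <-irrefl refl (begin-strict
    ℓ w          ≤⟨ ℓ≤supp ⟩
    support w    ≤⟨ count-mono m (λ i _ → uses-mono {w} {w′} closed-back) ⟩
    support w′   ≤⟨ support≤ℓ w′-perm ⟩
    ℓ w′         <⟨ subst (ℓ w′ <_) (sym (⋖.ℓ≡suc cov)) ≤-refl ⟩
    ℓ w          ∎)
    where open ≤-Reasoning

  module Peel (j : ℕ) (j<m : j < m) {w : Word (suc m)} (w-perm : Perm w) (w-fix : FixesAbove (suc j) w) where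
    open Adjacent m j j<m

    private
      fixes-rest : ∀ (σ : Word (suc m) → Word (suc m)) → (∀ q → suc j < toℕ q → lookup (σ w) q ≡ lookup w q) →
        lookup (σ w) d ≡ d → FixesAbove j (σ w)
      fixes-rest σ same-above σwd≡d =
        fixesAbove-pred d toℕ-d (fixesAbove λ q sj<q → trans (same-above q sj<q) (fixesAt w-fix q sj<q)) σwd≡d

    peel-left : lookup w d ≡ c → FixesAbove j (sˡ j w) × sˡ j w ⋖ w
    peel-left wd≡c = w′-fix , subst (sˡ j w ⋖_) (sˡ-involutive j w) (Left.σ-⋖ m j j<m (tmul-perm c d w-perm) w′-fix)
      where
      w′-fix : FixesAbove j (sˡ j w)
      w′-fix = fixes-rest (sˡ j) (λ q sj<q → lookup-tmul-other c d w q
                 (λ wq≡c → above⇒≢c (<-trans (n<1+n j) sj<q) (fixed-position w-fix q wq≡c sj<q))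
                 (λ wq≡d → above⇒≢d sj<q (fixed-position w-fix q wq≡d sj<q)))
               (lookup-tmul-left c d w d wd≡c)

    peel-right : lookup w c ≡ d → FixesAbove j (sʳ j w) × sʳ j w ⋖ w
    peel-right wc≡d = w′-fix , subst (sʳ j w ⋖_) (sʳ-involutive j w) (Right.σ-⋖ m j j<m (swapPos-perm c d w-perm) w′-fix)
      where
      w′-fix : FixesAbove j (sʳ j w)
      w′-fix = fixes-rest (sʳ j) (λ q sj<q → trans (lookup-swapPos c d w q)
                 (cong (lookup w) (transp-other c d q (above⇒≢c (<-trans (n<1+n j) sj<q)) (above⇒≢d sj<q))))
               (trans (lookup-swapPos c d w d) (trans (cong (lookup w) (transp-right c d)) wc≡d))

    closed-back-sˡ : ∀ {i′} → i′ ≢ j → Closed≤ i′ (sˡ j w) → Closed≤ i′ w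
    closed-back-sˡ i′≢j closed = subst (Closed≤ _) (sˡ-involutive j w) (closed≤-sˡ j j<m {y = sˡ j w} i′≢j closed)

    closed-back-sʳ : ∀ {i′} → i′ ≢ j → Closed≤ i′ (sʳ j w) → Closed≤ i′ w
    closed-back-sʳ i′≢j closed = subst (Closed≤ _) (sʳ-involutive j w) (closed≤-sʳ j j<m {y = sʳ j w} i′≢j closed)

    -- If w (j + 1) ∉ {j, j + 1} and w j ≠ j + 1, some cover below w keeps the whole
    -- support, which is then too large for the length of the smaller permutation.
    module Stuck (wd≢d : lookup w d ≢ d) (wd≢c : lookup w d ≢ c) (wc≢d : lookup w c ≢ d) where
      private
        q = proj₁ (preimage w-perm d)
        wq≡d = proj₂ (preimage w-perm d)
        r = proj₁ (preimage w-perm c)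
        wr≡c = proj₂ (preimage w-perm c)

        q<j : toℕ q < j
        q<j = ≤∧≢⇒< (≤-pred (≤∧≢⇒< (position-below w-fix q wq≡d (≤-reflexive toℕ-d))
                (λ q≡sj → wd≢d (trans (cong (lookup w) (toℕ-injective (trans toℕ-d (sym q≡sj)))) wq≡d))))
                (λ q≡j → wc≢d (trans (cong (lookup w) (toℕ-injective (trans toℕ-c (sym q≡j)))) wq≡d))

        r≤j : toℕ r ≤ j
        r≤j = ≤-pred (≤∧≢⇒< (position-below w-fix r wr≡c (≤-trans (≤-reflexive toℕ-c) (n≤1+n j)))
                (λ r≡sj → wd≢c (trans (cong (lookup w) (toℕ-injective (trans toℕ-d (sym r≡sj)))) wr≡c)))

        i₁ = toℕ q
        i₁<m : i₁ < m
        i₁<m = <-trans q<j j<m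

      left-cover : toℕ q < toℕ r → sˡ j w ⋖ w
      left-cover q<r = record
        { a = d ; b = c ; a≢b = c≢d ∘ sym
        ; x≡tmul = sym (trans (tmul-comm d c (sˡ j w)) (sˡ-involutive j w))
        ; ℓ≡suc = trans (ℓ-transpose-adjacentValues w-perm q r q<r adjacent)
                        (cong (suc ∘ ℓ) (trans (cong₂ (λ s t → tmul s t w) wq≡d wr≡c) (tmul-comm d c w))) }
        where
        adjacent : toℕ (lookup w q) ≡ suc (toℕ (lookup w r))
        adjacent = trans (cong toℕ wq≡d) (trans toℕ-d (cong suc (sym (trans (cong toℕ wr≡c) toℕ-c))))

      left-closed : ∀ {i} → Closed≤ i (sˡ j w) → Closed≤ i w
      left-closed {i} closed with i ℕ.≟ j
      ... | no i≢j = closed-back-sˡ i≢j closed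
      ... | yes refl = ⊥-elim (<-irrefl refl (subst (_≤ j) toℕ-d
            (subst (λ t → toℕ t ≤ j) (lookup-tmul-left c d w r wr≡c) (closed r r≤j))))

      right-cover : sʳ i₁ w ⋖ w
      right-cover = descent-⋖ w-perm i₁ i₁<m descent
        where
        open Adjacent m i₁ i₁<m renaming (c to q′; d to q⁺; toℕ-d to toℕ-q⁺)
        wq⁺≤sj : toℕ (lookup w q⁺) ≤ suc j
        wq⁺≤sj = value-below w-perm w-fix q⁺ (≤-trans (≤-reflexive toℕ-q⁺) (≤-trans q<j (n≤1+n j)))
        wq⁺≢sj : toℕ (lookup w q⁺) ≢ suc j
        wq⁺≢sj eq = <-irrefl (sym (cong toℕ q⁺≡q)) (subst (toℕ q <_) (sym toℕ-q⁺) ≤-refl)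
          where
          q⁺≡q : q⁺ ≡ q
          q⁺≡q = lookup-injective w-perm q⁺ q (trans (toℕ-injective (trans eq (sym toℕ-d))) (sym wq≡d))
        descent : Descent w i₁
        descent = subst (toℕ (lookup w q⁺) <_)
          (sym (trans (cong (toℕ ∘ lookup w) (clamp-toℕ m q)) (trans (cong toℕ wq≡d) toℕ-d)))
            (≤∧≢⇒< wq⁺≤sj wq⁺≢sj)

      right-closed : toℕ r < toℕ q → ∀ {i} → Closed≤ i (sʳ i₁ w) → Closed≤ i w
      right-closed r<q {i} closed with i ℕ.≟ i₁
      ... | no i≢i₁ = subst (Closed≤ i) (sʳ-involutive i₁ w) (closed≤-sʳ i₁ i₁<m {y = sʳ i₁ w} i≢i₁ closed)
        where open Adjacent m i₁ i₁<m renaming (c to q′; d to q⁺)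
      ... | yes refl = ⊥-elim (<⇒≱ q<j (subst (_≤ i₁) toℕ-c
          (subst (λ t → toℕ t ≤ i₁) w′r≡c (closed r (<⇒≤ r<q)))))
        where
        open Adjacent m i₁ i₁<m renaming (c to q′; d to q⁺; toℕ-c to toℕ-q′; toℕ-d to toℕ-q⁺)
        w′r≡c : lookup (sʳ i₁ w) r ≡ c
        w′r≡c = trans (lookup-swapPos q′ q⁺ w r) (trans (cong (lookup w) (transp-other q′ q⁺ r
          (λ r≡q′ → <-irrefl (trans (cong toℕ r≡q′) toℕ-q′) r<q)
          (λ r≡q⁺ → <-irrefl (trans (cong toℕ r≡q⁺) toℕ-q⁺) (<-trans r<q (n<1+n i₁))))) wr≡c)

      stuck : ¬ ℓ w ≤ support w
      stuck ℓ≤supp with <-cmp (toℕ q) (toℕ r)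
      ... | tri≈ _ q≡r _ = c≢d (trans (sym wr≡c) (trans (cong (lookup w) (sym (toℕ-injective q≡r))) wq≡d))
      ... | tri< q<r _ _ = same-support-⋖ (tmul-perm c d w-perm) (left-cover q<r) left-closed ℓ≤supp
      ... | tri> _ _ r<q = same-support-⋖ (swapPos-perm (clamp m i₁) (clamp m (suc i₁)) w-perm)
          right-cover (right-closed r<q) ℓ≤supp

  prepend-skip : ∀ {j w} → Coded j w → Coded (suc j) w
  prepend-skip C = record { code = skip ∷ code ; valid = valid
    ; length≡ = cong suc length≡ ; word≡ = word≡ ; weight≡ = weight≡ }
    where open Coded C

  prepend-left : ∀ {j w} → sˡ j w ⋖ w → Coded j (sˡ j w) → Coded (suc j) w
  prepend-left {j} {w} cov C = record
    { code = onLeft ∷ code ; valid = valid ; length≡ = cong suc length≡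
    ; word≡ = trans (cong (λ t → sˡ t (word code)) length≡) (trans (cong (sˡ j) word≡) (sˡ-involutive j w))
    ; weight≡ = trans (cong suc weight≡) (sym (⋖.ℓ≡suc cov)) }
    where open Coded C

  -- If s_(j-1) is absent, the right factor s_j is recorded as a left one.
  prepend-right : ∀ {j w} → j < m → Perm (sʳ j w) → FixesAbove j (sʳ j w) → sʳ j w ⋖ w → Coded j (sʳ j w) →
    Coded (suc j) w
  prepend-right {j} {w} j<m w′-perm w′-fix cov C = by-start (startsPresent? code)
    where
    open Coded C
    open Adjacent m j j<m
    w′c≡c : ¬ StartsPresent code → lookup (sʳ j w) c ≡ c
    w′c≡c absent = trans (cong (λ t → lookup t c) (sym word≡))
      (subst (λ t → lookup (word code) (clamp m t) ≡ clamp m t) length≡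
        (word-fixes-next code (subst (_≤ m) (sym length≡) (<⇒≤ j<m)) absent))
    sʳ≡sˡ : ¬ StartsPresent code → sʳ j (sʳ j w) ≡ sˡ j (sʳ j w)
    sʳ≡sˡ absent = trans (swapPos≡tmul c d w′-perm)
      (cong₂ (λ s t → tmul s t (sʳ j w)) (w′c≡c absent) (fixesAt w′-fix d j<d))
    by-start : Dec (StartsPresent code) → Coded (suc j) w
    by-start (yes present) = record
      { code = onRight ∷ code ; valid = valid , present ; length≡ = cong suc length≡
      ; word≡ = trans (cong (λ t → sʳ t (word code)) length≡) (trans (cong (sʳ j) word≡) (sʳ-involutive j w))
      ; weight≡ = trans (cong suc weight≡) (sym (⋖.ℓ≡suc cov)) }
    by-start (no absent) = record
      { code = onLeft ∷ code ; valid = valid ; length≡ = cong suc length≡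
      ; word≡ = trans (cong (λ t → sˡ t (word code)) length≡)
                  (trans (cong (sˡ j) word≡) (trans (sym (sʳ≡sˡ absent)) (sʳ-involutive j w)))
      ; weight≡ = trans (cong suc weight≡) (sym (⋖.ℓ≡suc cov)) }

  coded : ∀ j → j ≤ m → ∀ {w} → Perm w → FixesAbove j w → ℓ w ≤ support w → Coded j w
  coded zero _ w-perm w-fix _ = record
    { code = [] ; valid = tt ; length≡ = refl ; word≡ = sym w≡identity
    ; weight≡ = sym (trans (cong ℓ w≡identity) ℓ-identity) }
    where w≡identity = fixesAbove-0⇒identity w-perm w-fix
  coded (suc j) j<m {w} w-perm w-fix ℓ≤supp = peel (lookup w d ≟ d) (lookup w d ≟ c) (lookup w c ≟ d)
    where
    open Adjacent m j j<m
    open Peel j j<m w-perm w-fix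
    recurse : ∀ {w′} → Perm w′ → FixesAbove j w′ → ℓ w′ ≤ support w′ → Coded j w′
    recurse = coded j (<⇒≤ j<m)
    peel : Dec (lookup w d ≡ d) → Dec (lookup w d ≡ c) → Dec (lookup w c ≡ d) → Coded (suc j) w
    peel (yes wd≡d) _ _ = prepend-skip (recurse w-perm (fixesAbove-pred d toℕ-d w-fix wd≡d) ℓ≤supp)
    peel (no _) (yes wd≡c) _ = let (w′-fix , cov) = peel-left wd≡c in
      prepend-left cov (recurse (tmul-perm c d w-perm) w′-fix (ℓ≤support-⋖ j cov closed-back-sˡ ℓ≤supp))
    peel (no _) (no _) (yes wc≡d) = let (w′-fix , cov) = peel-right wc≡d in
      prepend-right j<m (swapPos-perm c d w-perm) w′-fix cov
        (recurse (swapPos-perm c d w-perm) w′-fix (ℓ≤support-⋖ j cov closed-back-sʳ ℓ≤supp))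
    peel (no wd≢d) (no wd≢c) (no wc≢d) = ⊥-elim (Stuck.stuck wd≢d wd≢c wc≢d ℓ≤supp)

  -- A code is recovered from its word letter by letter: the top letter is read off
  -- the value at the position above the rest of the code, which is then recovered
  -- by undoing that letter.
  topLetter : ℕ → Word (suc m) → Letter
  topLetter j u with lookup u (clamp m (suc j)) ≟ clamp m (suc j)
  ... | yes _ = skip
  ... | no _ with lookup u (clamp m (suc j)) ≟ clamp m j
  ...   | yes _ = onLeft
  ...   | no _ = onRight

  topLetter-skip : ∀ {j u} → lookup u (clamp m (suc j)) ≡ clamp m (suc j) → topLetter j u ≡ skip
  topLetter-skip {j} {u} fixed with lookup u (clamp m (suc j)) ≟ clamp m (suc j)
  ... | yes _ = refl
  ... | no moved = contradiction fixed moved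

  topLetter-left : ∀ {j u} → j < m → lookup u (clamp m (suc j)) ≡ clamp m j → topLetter j u ≡ onLeft
  topLetter-left {j} {u} j<m ud≡c with lookup u (clamp m (suc j)) ≟ clamp m (suc j)
  ... | yes ud≡d = contradiction (trans (sym ud≡c) ud≡d) (Adjacent.c≢d m j j<m)
  ... | no _ with lookup u (clamp m (suc j)) ≟ clamp m j
  ...   | yes _ = refl
  ...   | no ud≢c = contradiction ud≡c ud≢c

  topLetter-right : ∀ {j u} → lookup u (clamp m (suc j)) ≢ clamp m (suc j) → lookup u (clamp m (suc j)) ≢ clamp m j →
    topLetter j u ≡ onRight
  topLetter-right {j} {u} ud≢d ud≢c with lookup u (clamp m (suc j)) ≟ clamp m (suc j)
  ... | yes ud≡d = contradiction ud≡d ud≢d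
  ... | no _ with lookup u (clamp m (suc j)) ≟ clamp m j
  ...   | yes ud≡c = contradiction ud≡c ud≢c
  ...   | no _ = refl

  private
    moves-top : ∀ cs (M : SideMultiplication {suc m} (length cs)) → suc (length cs) ≤ m →
      lookup (SideMultiplication.σ M (word cs)) (clamp m (suc (length cs))) ≢ clamp m (suc (length cs))
    moves-top cs M sk≤m fixed =
      σ-moves perm′ fixes (fixesAbove-pred _ (toℕ-clamp m _ sk≤m) (σ-fixesAbove perm′ fixes) fixed)
      where
      open SideMultiplication M
      open BooleanPerm (word-boolean cs (≤-trans (n≤1+n _) sk≤m))

  word-moves-top : ∀ cs → length cs ≤ m → StartsPresent cs →
    lookup (word cs) (clamp m (length cs)) ≢ clamp m (length cs)
  word-moves-top (onLeft ∷ cs) k≤m _ = moves-top cs (Left.leftMultiplication m (length cs) k≤m) k≤m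
  word-moves-top (onRight ∷ cs) k≤m _ = moves-top cs (Right.rightMultiplication m (length cs) k≤m) k≤m

  topLetter-word : ∀ a cs → Valid (a ∷ cs) → suc (length cs) ≤ m → topLetter (length cs) (word (a ∷ cs)) ≡ a
  topLetter-word skip cs _ sk<m = topLetter-skip {u = word cs} (fixesAt (BooleanPerm.fixes (word-boolean cs (<⇒≤ sk<m))) _ j<d)
    where open Adjacent m (length cs) sk<m
  topLetter-word onLeft cs _ sk<m =
    topLetter-left {u = word (onLeft ∷ cs)} sk<m
      (lookup-tmul-right c d (word cs) d (fixesAt (BooleanPerm.fixes (word-boolean cs (<⇒≤ sk<m))) d j<d))
    where open Adjacent m (length cs) sk<m
  topLetter-word onRight cs (_ , present) sk<m = topLetter-right {u = word (onRight ∷ cs)}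
    (λ u-d≡d → c≢d (lookup-injective (BooleanPerm.perm′ (word-boolean cs (<⇒≤ sk<m))) c d
      (trans (sym u-d≡) (trans u-d≡d (sym wd≡d)))))
    (λ u-d≡c → word-moves-top cs (<⇒≤ sk<m) present (trans (sym u-d≡) u-d≡c))
    where
    open Adjacent m (length cs) sk<m
    u-d≡ : lookup (sʳ (length cs) (word cs)) d ≡ lookup (word cs) c
    u-d≡ = trans (lookup-swapPos c d (word cs) d) (cong (lookup (word cs)) (transp-right c d))
    wd≡d : lookup (word cs) d ≡ d
    wd≡d = fixesAt (BooleanPerm.fixes (word-boolean cs (<⇒≤ sk<m))) d j<d

  word-tail : ∀ a cs cs′ → length cs ≡ length cs′ → word (a ∷ cs) ≡ word (a ∷ cs′) → word cs ≡ word cs′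
  word-tail skip cs cs′ _ eq = eq
  word-tail onLeft cs cs′ len≡ eq = begin
    word cs                                          ≡⟨ sˡ-involutive (length cs) (word cs) ⟨
    sˡ (length cs) (sˡ (length cs) (word cs))        ≡⟨ cong (sˡ (length cs)) eq ⟩
    sˡ (length cs) (sˡ (length cs′) (word cs′))      ≡⟨ cong (λ t → sˡ t (sˡ (length cs′) (word cs′))) len≡ ⟩
    sˡ (length cs′) (sˡ (length cs′) (word cs′))     ≡⟨ sˡ-involutive (length cs′) (word cs′) ⟩
    word cs′                                         ∎
    where open ≡-Reasoning
  word-tail onRight cs cs′ len≡ eq = begin
    word cs                                          ≡⟨ sʳ-involutive (length cs) (word cs) ⟨
    sʳ (length cs) (sʳ (length cs) (word cs))        ≡⟨ cong (sʳ (length cs)) eq ⟩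
    sʳ (length cs) (sʳ (length cs′) (word cs′))      ≡⟨ cong (λ t → sʳ t (sʳ (length cs′) (word cs′))) len≡ ⟩
    sʳ (length cs′) (sʳ (length cs′) (word cs′))     ≡⟨ sʳ-involutive (length cs′) (word cs′) ⟩
    word cs′                                         ∎
    where open ≡-Reasoning

  valid-tail : ∀ a cs → Valid (a ∷ cs) → Valid cs
  valid-tail skip _ valid = valid
  valid-tail onLeft _ valid = valid
  valid-tail onRight _ (valid , _) = valid

  word-injective : ∀ cs cs′ → Valid cs → Valid cs′ → length cs ≡ length cs′ → length cs ≤ m →
    word cs ≡ word cs′ → cs ≡ cs′
  word-injective [] [] _ _ _ _ _ = refl
  word-injective (a ∷ cs) (b ∷ cs′) valid valid′ len≡ k≤m eq with same-top
    where
    len≡′ = suc-injective len≡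
    same-top : a ≡ b
    same-top = trans (sym (topLetter-word a cs valid k≤m))
      (trans (cong₂ topLetter len≡′ eq) (topLetter-word b cs′ valid′ (subst (λ t → suc t ≤ m) len≡′ k≤m)))
  ... | refl = cong (a ∷_) (word-injective cs cs′ (valid-tail a cs valid) (valid-tail a cs′ valid′)
                 (suc-injective len≡) (≤-trans (n≤1+n _) k≤m) (word-tail a cs cs′ (suc-injective len≡) eq))

  fixesAbove-top : ∀ (w : Word (suc m)) → FixesAbove m w
  fixesAbove-top w = fixesAbove λ q m<q → contradiction (≤-pred (FP.toℕ<n q)) (<⇒≱ m<q)

  word-injective-on-codes : ∀ {k cs cs′} → cs ∈ codes m k → cs′ ∈ codes m k → word cs ≡ word cs′ → cs ≡ cs′
  word-injective-on-codes {k} cs∈ cs′∈ eq =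
    let (valid , len≡ , _) = ∈codes⇒good m k cs∈
        (valid′ , len≡′ , _) = ∈codes⇒good m k cs′∈
    in word-injective _ _ valid valid′ (trans len≡ (sym len≡′)) (≤-reflexive len≡) eq

  ∈codes⇒boolean : ∀ {k cs} → cs ∈ codes m k → IsPerm (word cs) × len (word cs) ≡ k × IsBooleanB (word cs)
  ∈codes⇒boolean {k} {cs} cs∈ =
    lookup-injective perm′ , trans (sym (ℓ≡len (word cs))) (trans ℓ≡ weight≡) , booleanIdeal⇒IsBooleanB boolean
    where
    good = ∈codes⇒good m k cs∈
    weight≡ = proj₂ (proj₂ good)
    open BooleanPerm (word-boolean cs (≤-reflexive (proj₁ (proj₂ good))))

  ∈words⇒boolean : ∀ {k w} → w ∈ L.map word (codes m k) → IsPerm w × len w ≡ k × IsBooleanB w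
  ∈words⇒boolean {k} w∈ with ∈-map⁻ word w∈
  ... | cs , cs∈ , refl = ∈codes⇒boolean cs∈

  boolean⇒∈words : ∀ {k w} → IsPerm w → len w ≡ k → IsBooleanB w → w ∈ L.map word (codes m k)
  boolean⇒∈words {k} {w} w-perm len≡k w-boolean = subst (_∈ L.map word (codes m k)) word≡
    (∈-map⁺ word (subst (λ t → code ∈ codes t k) length≡
      (subst (λ t → code ∈ codes (length code) t) (trans weight≡ (trans (ℓ≡len w) len≡k)) (valid⇒∈codes code valid))))
    where
    open Coded (coded m ≤-refl (perm w-perm) (fixesAbove-top w)
                  (ℓ≤support (perm w-perm) (proj₂ (IsBooleanB⇒booleanIdeal w-boolean))))

corollary5p5 : (n k : ℕ) → 1 ≤ n → Σ (List (Word n)) λ ws →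
    Unique ws ×
    (∀ w → (w ∈ ws) ⇔ (IsPerm w × (len w ≡ k) × IsBooleanB w)) ×
    (length ws ≡ formula n k)
corollary5p5 (suc m) k _ = L.map word (codes m k) , unique , members , size
  where
  open Codes m
  unique : Unique (L.map word (codes m k))
  unique = Unique-map word (codes m k) (codes-unique m k) word-injective-on-codes
  members : ∀ w → (w ∈ L.map word (codes m k)) ⇔ (IsPerm w × len w ≡ k × IsBooleanB w)
  members w = mk⇔ ∈words⇒boolean (λ (w-perm , len≡k , w-boolean) → boolean⇒∈words w-perm len≡k w-boolean)
  size : length (L.map word (codes m k)) ≡ formula (suc m) k
  size = trans (length-map word (codes m k)) (trans (length-codes m k) (codeCount≡formula m k))
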